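{- Let $r,s$ be positive integers and let $a_1,\ldots,a_r,b_1,\ldots,b_s$ be nonnegative integers. Then in the shuffle algebra $(\mathfrak{h},\,\sqcup\!\sqcup\,)$, $$x^{a_1}y\cdots x^{a_r}y\;\sqcup\!\sqcup\; x^{b_1}y\cdots x^{b_s}y=\sum_{\substack{\alpha_1+\cdots+\alpha_{r+s}=\sum_{i=1}^r a_i+\sum_{j=1}^s b_j\\ \alpha_1,\ldots,\alpha_{r+s}\ge 0}} c_{\alpha_1,\ldots,\alpha_{r+s}}\, x^{\alpha_1}y x^{\alpha_2}y\cdots x^{\alpha_{r+s}}y,$$ where \begin{align*} c_{\alpha_1,\ldots,\alpha_{r+s}}=&\sum_{\substack{l_1+\cdots+l_{p+1}=r,\ n_1+\cdots+n_p=s\\ p\ge1,\ l_i\ge1,\ n_j\ge1}}\prod_{i=1}^{L_p+s}\binom{\alpha_i}{\beta_i}\prod_{j=L_p+s+2}^{r+s}\delta_{\alpha_j,a_{j-s}} +\sum_{\substack{l_1+\cdots+l_{p}=r,\ n_1+\cdots+n_p=s\\ p\ge1,\ l_i\ge1,\ n_j\ge1}}\prod_{i=1}^{r+N_{p-1}}\binom{\alpha_i}{\beta_i}\prod_{j=r+N_{p-1}+2}^{r+s}\delta_{\alpha_j,b_{j-r}}\\ &+\sum_{\substack{l_1+\cdots+l_{p}=r,\ n_1+\cdots+n_{p+1}=s\\ p\ge1,\ l_i\ge1,\ n_j\ge1}}\prod_{i=1}^{r+N_{p}}\binom{\alpha_i}{\gamma_i}\prod_{j=r+N_{p}+2}^{r+s}\delta_{\alpha_j,b_{j-r}}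 +\sum_{\substack{l_1+\cdots+l_{p}=r,\ n_1+\cdots+n_p=s\\ p\ge1,\ l_i\ge1,\ n_j\ge1}}\prod_{i=1}^{L_{p-1}+s}\binom{\alpha_i}{\gamma_i}\prod_{j=L_{p-1}+s+2}^{r+s}\delta_{\alpha_j,a_{j-s}}. \end{align*} Here, for the positive integers $l_1,\ldots,l_p(,l_{p+1})$ and $n_1,\ldots,n_p(,n_{p+1})$ occurring in each summation, $L_j=l_1+\cdots+l_j$, $N_j=n_1+\cdots+n_j$ ($L_0=N_0=0$), and the integers $\beta_i$ and $\gamma_i$ are defined by $$\begin{cases}\beta_{L_j+N_j+1}=\sum_{i=1}^{L_j+1}a_i+\sum_{i=1}^{N_j}b_i-\sum_{i=1}^{L_j+N_j}\alpha_i,\quad \beta_{L_j+N_j+t}=a_{L_j+t}\ (2\le t\le l_{j+1}), & j=0,1,\ldots,p,\\ \beta_{L_{j+1}+N_j+1}=\sum_{i=1}^{L_{j+1}}a_i+\sum_{i=1}^{N_j+1}b_i-\sum_{i=1}^{L_{j+1}+N_j}\alpha_i,\quad \beta_{L_{j+1}+N_j+t}=b_{N_j+t}\ (2\le t\le n_{j+1}), & j=0,1,\ldots,p-1,\end{cases}$$ and $$\begin{cases}\gamma_{L_j+N_j+1}=\sum_{i=1}^{L_j}a_i+\sum_{i=1}^{N_j+1}b_i-\sum_{i=1}^{L_j+N_j}\alpha_i,\quad \gamma_{L_j+N_j+t}=b_{N_j+t}\ (2\le t\le n_{j+1}), & j=0,1,\ldots,p,\\ \gamma_{L_j+N_{j+1}+1}=\sum_{i=1}^{L_j+1}a_i+\sum_{i=1}^{N_{j+1}}b_i-\sum_{i=1}^{L_j+N_{j+1}}\alpha_i,\quad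 \gamma_{L_j+N_{j+1}+t}=a_{L_j+t}\ (2\le t\le l_{j+1}), & j=0,1,\ldots,p-1,\end{cases}$$ (each defined whenever the indices involved are among the $l$'s and $n$'s of the given summation).
   Context: Let $A=\{x,y\}$ be an alphabet of two non-commuting letters, $A^*$ the set of words (including the empty word $1$), and $\mathfrak{h}=\mathbb{Q}\langle x,y\rangle$ the $\mathbb{Q}$-vector space spanned by $A^*$. The shuffle product $\sqcup\!\sqcup$ on $\mathfrak{h}$ is the $\mathbb{Q}$-bilinear product defined by $1\sqcup\!\sqcup w=w\sqcup\!\sqcup 1=w$ and $aw_1\sqcup\!\sqcup bw_2=a(w_1\sqcup\!\sqcup bw_2)+b(aw_1\sqcup\!\sqcup w_2)$ for letters $a,b\in A$ and words $w,w_1,w_2$. Conventions: $\delta_{ij}$ is the Kronecker delta; for integers $\alpha,\beta$ the binomial coefficient $\binom{\alpha}{\beta}$ is taken to be $0$ if $\beta<0$ or $\alpha<\beta$; empty products equal $1$. -}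

module Defs where

open import Data.Nat as ℕ using (ℕ; zero; suc; _+_; _*_; _∸_; _≡ᵇ_)
open import Data.Nat.Combinatorics using (_C_)
open import Data.Integer as ℤ using (ℤ; +_; -[1+_])
open import Data.Rational as ℚ using (ℚ; 0ℚ; 1ℚ)
open import Data.Bool using (Bool; true; false; if_then_else_; _∧_)
open import Data.List using (List; []; _∷_; [_]; _++_; map; concatMap; filter;
  upTo; length; take; replicate)
open import Data.List.Properties using (≡-dec)
open import Data.Nat.ListAction using (sum; product)
open import Data.Product using (_×_; _,_)
open import Relation.Binary.PropositionalEquality using (_≡_; refl)
open import Relation.Nullary using (Dec; yes; no; does)

data Letter : Set where
  x y : Letter

_≟L_ : (a b : Letter) → Dec (a ≡ b)
x ≟L x = yes refl
x ≟L y = no (λ ())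
y ≟L x = no (λ ())
y ≟L y = yes refl

Word : Set
Word = List Letter

_≟W_ : (u v : Word) → Dec (u ≡ v)
_≟W_ = ≡-dec _≟L_

-- An element of 𝔥 is represented by a finite formal Q-linear combination
-- Σ c_k w_k of words (a list of (coefficient , word) pairs).
𝔥 : Set
𝔥 = List (ℚ × Word)

coeff : Word → 𝔥 → ℚ
coeff w [] = 0ℚ
coeff w ((c , u) ∷ p) = (if does (u ≟W w) then c else 0ℚ) ℚ.+ coeff w p

infix 4 _≈𝔥_
_≈𝔥_ : 𝔥 → 𝔥 → Set
p ≈𝔥 q = ∀ (w : Word) → coeff w p ≡ coeff w q

word : Word → 𝔥
word w = [ (1ℚ , w) ]

_·_ : Letter → 𝔥 → 𝔥
a · p = map (λ { (c , w) → (c , a ∷ w) }) p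

_ш_ : Word → Word → 𝔥
[] ш w = word w
(a ∷ u) ш [] = word (a ∷ u)
(a ∷ u) ш (b ∷ v) = (a · (u ш (b ∷ v))) ++ (b · ((a ∷ u) ш v))

scale : ℚ → 𝔥 → 𝔥
scale c = map (λ { (d , w) → (c ℚ.* d , w) })

_ш𝔥_ : 𝔥 → 𝔥 → 𝔥
p ш𝔥 q = concatMap (λ { (c , u) → concatMap (λ { (d , v) → scale (c ℚ.* d) (u ш v) }) q }) p

xy-word : List ℕ → Word
xy-word ks = concatMap (λ k → replicate k x ++ [ y ]) ks

allLists : ℕ → List ℕ → List (List ℕ)
allLists zero R = [ [] ]
allLists (suc k) R = concatMap (λ e → map (e ∷_) (allLists k R)) R

compositions : ℕ → List (List ℕ)
compositions n =
  filter (λ c → sum c ℕ.≟ n)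
         (concatMap (λ k → allLists k (map suc (upTo n))) (upTo (suc n)))

weakCompositions : ℕ → ℕ → List (List ℕ)
weakCompositions k n = filter (λ c → sum c ℕ.≟ n) (allLists k (upTo (suc n)))

-- 1-indexed access (value 0 outside the range; never used there)
at : List ℕ → ℕ → ℕ
at [] _ = 0
at (v ∷ vs) zero = 0
at (v ∷ vs) (suc zero) = v
at (v ∷ vs) (suc (suc i)) = at vs (suc i)

atℤ : List ℤ → ℕ → ℤ
atℤ [] _ = + 0
atℤ (v ∷ vs) zero = + 0
atℤ (v ∷ vs) (suc zero) = v
atℤ (v ∷ vs) (suc (suc i)) = atℤ vs (suc i)

sumTo : List ℕ → ℕ → ℕ
sumTo vs k = sum (take k vs)

range : ℕ → ℕ → List ℕ
range lo hi = map (λ i → lo + i) (upTo (suc hi ∸ lo))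

prodRange : ℕ → ℕ → (ℕ → ℕ) → ℕ
prodRange lo hi f = product (map f (range lo hi))

-- binomial coefficient (α choose β) for integer β, 0 if β < 0 or α < β
binom : ℕ → ℤ → ℕ
binom n (+ k) = n C k
binom n -[1+ k ] = 0

δ : ℕ → ℕ → ℕ
δ m n = if m ≡ᵇ n then 1 else 0

data Tag : Set where
  A B : Tag

-- alternating block structure: starting with tag t, blocks of a-letters of
-- lengths l₁,l₂,… (tag A) alternate with blocks of b-letters n₁,n₂,… (tag B)
alt : Tag → List ℕ → List ℕ → List (Tag × ℕ)
alt A [] ns = []
alt A (l ∷ ls) ns = (A , l) ∷ alt B ls ns
alt B ls [] = []
alt B ls (n ∷ ns) = (B , n) ∷ alt A ls ns

-- Given a, b, α and a block structure, produce the sequence of integers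
-- defined by the paper's rules, where ca = L (number of a-indices already
-- used) and cb = N (number of b-indices already used) before the block:
--   A-block of length l:  entry L+N+1 = Σ_{i≤L+1} aᵢ + Σ_{i≤N} bᵢ − Σ_{i≤L+N} αᵢ,
--                         entry L+N+t = a_{L+t}  (2 ≤ t ≤ l)
--   B-block of length n:  entry L+N+1 = Σ_{i≤L} aᵢ + Σ_{i≤N+1} bᵢ − Σ_{i≤L+N} αᵢ,
--                         entry L+N+t = b_{N+t}  (2 ≤ t ≤ n)
blockSeq : (a b α : List ℕ) → (ca cb : ℕ) → List (Tag × ℕ) → List ℤ
blockSeq a b α ca cb [] = []
blockSeq a b α ca cb ((A , l) ∷ bs) =
  ((+ (sumTo a (suc ca) + sumTo b cb)) ℤ.- (+ sumTo α (ca + cb)))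
  ∷ (map (λ t → + at a (ca + t)) (range 2 l) ++ blockSeq a b α (ca + l) cb bs)
blockSeq a b α ca cb ((B , n) ∷ bs) =
  ((+ (sumTo a ca + sumTo b (suc cb))) ℤ.- (+ sumTo α (ca + cb)))
  ∷ (map (λ t → + at b (cb + t)) (range 2 n) ++ blockSeq a b α ca (cb + n) bs)

-- β (blocks l₁, n₁, l₂, n₂, …) and γ (blocks n₁, l₁, n₂, l₂, …)
βseq : (a b α ls ns : List ℕ) → List ℤ
βseq a b α ls ns = blockSeq a b α 0 0 (alt A ls ns)

γseq : (a b α ls ns : List ℕ) → List ℤ
γseq a b α ls ns = blockSeq a b α 0 0 (alt B ls ns)

ind : Bool → ℕ → ℕ
ind c v = if c then v else 0

sumComps : ℕ → ℕ → (List ℕ → List ℕ → ℕ) → ℕ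
sumComps r s f =
  sum (concatMap (λ ls → map (λ ns → f ls ns) (compositions s)) (compositions r))

module _ (r s : ℕ) (a b α : List ℕ) where

  term₁ : List ℕ → List ℕ → ℕ
  term₁ ls ns =
    let p  = length ns
        β  = βseq a b α ls ns
        Lp = sumTo ls p
    in ind ((length ls ≡ᵇ suc p) ∧ (1 ℕ.≤ᵇ p))
         (prodRange 1 (Lp + s) (λ i → binom (at α i) (atℤ β i))
          * prodRange (Lp + s + 2) (r + s) (λ j → δ (at α j) (at a (j ∸ s))))

  term₂ : List ℕ → List ℕ → ℕ
  term₂ ls ns =
    let p  = length ls
        β  = βseq a b α ls ns
        N  = sumTo ns (p ∸ 1)
    in ind ((length ns ≡ᵇ p) ∧ (1 ℕ.≤ᵇ p))
         (prodRange 1 (r + N) (λ i → binom (at α i) (atℤ β i))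
          * prodRange (r + N + 2) (r + s) (λ j → δ (at α j) (at b (j ∸ r))))

  term₃ : List ℕ → List ℕ → ℕ
  term₃ ls ns =
    let p  = length ls
        γ  = γseq a b α ls ns
        Np = sumTo ns p
    in ind ((length ns ≡ᵇ suc p) ∧ (1 ℕ.≤ᵇ p))
         (prodRange 1 (r + Np) (λ i → binom (at α i) (atℤ γ i))
          * prodRange (r + Np + 2) (r + s) (λ j → δ (at α j) (at b (j ∸ r))))

  term₄ : List ℕ → List ℕ → ℕ
  term₄ ls ns =
    let p  = length ls
        γ  = γseq a b α ls ns
        L  = sumTo ls (p ∸ 1)
    in ind ((length ns ≡ᵇ p) ∧ (1 ℕ.≤ᵇ p))
         (prodRange 1 (L + s) (λ i → binom (at α i) (atℤ γ i))
          * prodRange (L + s + 2) (r + s) (λ j → δ (at α j) (at a (j ∸ s))))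

  cCoeff : ℕ
  cCoeff = sumComps r s term₁ + sumComps r s term₂
         + sumComps r s term₃ + sumComps r s term₄

rhs : (r s : ℕ) → (a b : List ℕ) → 𝔥
rhs r s a b =
  map (λ α → ((+ cCoeff r s a b α) ℚ./ 1 , xy-word α))
      (weakCompositions (r + s) (sum a + sum b))

{-# OPTIONS --safe #-}
module Submission where

-- The coefficient of w in u ш v counts the ways of interleaving u and v into w; for
-- xy-words it vanishes unless w = x^α₁y⋯x^α_{r+s}y with Σα = Σa + Σb.  The first y of w comes from
-- one of the two words; if it is the y of x^a₁y, the α₁ letters x before it are a₁ from the first
-- word and α₁ − a₁ from the second, in C(α₁, a₁) ways, and the second word keeps a₁ + b₁ − α₁ of its
-- leading letters x (symmetrically if the y comes from the second word).  With integer exponents,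
-- binomials vanishing at negative arguments, this recurrence unfolds until one word is used up.
-- Grouping consecutive steps that take their y from the same word into blocks turns the unfolding
-- into a sum over alternating block lengths l₁, n₁, l₂, … (compositions of r and s); along a
-- pattern the carried exponents are the paper's β (first block from the first word) or γ, and once a
-- word is exhausted the remaining exponents must coincide, giving the Kronecker deltas.  The four
-- sums of the theorem are the four choices of the words supplying the first and the last block.

open import Defs
open import Data.Nat using (ℕ; _≤_; _+_)
open import Data.Vec using (Vec; toList)

open import Data.Nat as ℕ using (zero; suc; _*_; _∸_; _<_; z≤n; s≤s; _≡ᵇ_)
import Data.Nat.Properties as NP
open import Data.Nat.Combinatorics using (_C_; nCk+nC[k+1]≡[n+1]C[k+1]; k>n⇒nCk≡0; nCn≡1)
open import Data.Nat.ListAction using (sum; product)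
import Data.Nat.Solver as NS
import Data.Nat.Coprimality as Cop
open import Data.Integer as ℤ using (ℤ; -[1+_])
import Data.Integer.Properties as ZP
import Data.Integer.Solver as ZS
open import Data.Rational as ℚ using (ℚ; 0ℚ; 1ℚ; mkℚ)
import Data.Rational.Properties as QP
import Data.Sign.Base
open import Data.Bool using (Bool; true; false; if_then_else_; _∧_)
open import Data.List using (List; []; _∷_; _++_; [_]; map; replicate; length; concatMap; filter; upTo; applyUpTo; take; drop; foldr)
import Data.List.Properties as LP
open import Data.List.Relation.Unary.All using (All; []; _∷_)
import Data.List.Relation.Unary.All as All
open import Data.Product using (_×_; _,_; Σ; proj₂)
open import Data.Sum using (_⊎_; inj₁; inj₂)
open import Data.Empty using (⊥; ⊥-elim)
open import Relation.Nullary using (Dec; yes; no; does; ¬_)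
open import Relation.Unary using (Pred; Decidable)
open import Relation.Binary.PropositionalEquality hiding ([_])
import Data.Vec.Properties as VP
open import Relation.Nullary.Decidable using (dec-true; dec-false; does-⇔; decidable-stable)
open import Algebra.Properties.CommutativeSemigroup NP.+-commutativeSemigroup
  using () renaming (interchange to [m+n]+[o+p]≡[m+o]+[n+p]; x∙yz≈y∙xz to m+[n+o]≡n+[m+o])
open import Algebra.Properties.CommutativeSemigroup NP.*-commutativeSemigroup
  using () renaming (x∙yz≈y∙xz to m*[n*o]≡n*[m*o])
open import Algebra.Properties.AbelianGroup ZP.+-0-abelianGroup using () renaming (∙-cancelʳ to ℤ-+-cancelʳ)
open import Function.Bundles using (mk⇔)
open import Function.Base using (case_of_)


-- Coefficients of shuffles

toℚ : ℕ → ℚ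
toℚ n = (ℤ.+ n) ℚ./ 1

toℚ≡mkℚ : ∀ n → toℚ n ≡ mkℚ (ℤ.+ n) 0 (Cop.sym (Cop.1-coprimeTo n))
toℚ≡mkℚ n = QP.normalize-coprime (Cop.sym (Cop.1-coprimeTo n))

+◃≡+ : ∀ n → (Data.Sign.Base.Sign.+ ℤ.◃ n) ≡ ℤ.+ n
+◃≡+ zero = refl
+◃≡+ (suc n) = refl

toℚ-+ : ∀ m n → toℚ (m ℕ.+ n) ≡ toℚ m ℚ.+ toℚ n
toℚ-+ m n rewrite toℚ≡mkℚ m | toℚ≡mkℚ n | NP.*-identityʳ m | NP.*-identityʳ n | +◃≡+ m | +◃≡+ n = refl


toℕ : Bool → ℕ
toℕ true = 1
toℕ false = 0

χ : ∀ {p} {P : Set p} → Dec P → ℕ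
χ d = toℕ (does d)

χ-yes : ∀ {p} {P : Set p} (d : Dec P) → P → χ d ≡ 1
χ-yes d p rewrite dec-true d p = refl

χ-no : ∀ {p} {P : Set p} (d : Dec P) → ¬ P → χ d ≡ 0
χ-no d ¬p rewrite dec-false d ¬p = refl

χ≢0 : ∀ {p} {P : Set p} (d : Dec P) → χ d ≢ 0 → P
χ≢0 (yes p) _ = p
χ≢0 (no _) h = ⊥-elim (h refl)

χ-*≢0 : ∀ {p} {P : Set p} (d : Dec P) {n} → χ d * n ≢ 0 → P × n ≢ 0
χ-*≢0 (yes p) h = p , λ n≡0 → h (trans (NP.+-identityʳ _) n≡0)
χ-*≢0 (no _) h = ⊥-elim (h refl)

m+n≢0⇒m≢0⊎n≢0 : ∀ m n → m + n ≢ 0 → m ≢ 0 ⊎ n ≢ 0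
m+n≢0⇒m≢0⊎n≢0 zero n h = inj₂ h
m+n≢0⇒m≢0⊎n≢0 (suc m) n h = inj₁ (λ ())

toℕ-∧ : ∀ a b → toℕ (a ∧ b) ≡ toℕ a * toℕ b
toℕ-∧ true b = sym (NP.+-identityʳ (toℕ b))
toℕ-∧ false b = refl

shuffleCount : Word → Word → Word → ℕ
shuffleCount [] v w = χ (v ≟W w)
shuffleCount (a ∷ u) [] w = χ ((a ∷ u) ≟W w)
shuffleCount (a ∷ u) (b ∷ v) [] = 0
shuffleCount (a ∷ u) (b ∷ v) (c ∷ w) =
  χ (a ≟L c) * shuffleCount u (b ∷ v) w + χ (b ≟L c) * shuffleCount (a ∷ u) v w

coeff-++ : ∀ w p q → coeff w (p ++ q) ≡ coeff w p ℚ.+ coeff w q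
coeff-++ w [] q = sym (QP.+-identityˡ (coeff w q))
coeff-++ w ((c , u) ∷ p) q =
  trans (cong (d ℚ.+_) (coeff-++ w p q)) (sym (QP.+-assoc d (coeff w p) (coeff w q)))
  where d = if does (u ≟W w) then c else 0ℚ

coeff-[]-· : ∀ a p → coeff [] (a · p) ≡ 0ℚ
coeff-[]-· a [] = refl
coeff-[]-· a ((c , u) ∷ p) = trans (cong (0ℚ ℚ.+_) (coeff-[]-· a p)) (QP.+-identityʳ 0ℚ)

coeff-∷-· : ∀ a c w p → coeff (c ∷ w) (a · p) ≡ (if does (a ≟L c) then coeff w p else 0ℚ)
coeff-∷-· a c w [] with does (a ≟L c)
... | true = refl
... | false = refl
coeff-∷-· a c w ((d , u) ∷ p) =
  trans (cong ((if does (a ≟L c) ∧ does (u ≟W w) then d else 0ℚ) ℚ.+_) (coeff-∷-· a c w p)) (if-∧ (does (a ≟L c)) (does (u ≟W w)))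
  where
  if-∧ : ∀ b b′ → (if b ∧ b′ then d else 0ℚ) ℚ.+ (if b then coeff w p else 0ℚ)
                 ≡ (if b then (if b′ then d else 0ℚ) ℚ.+ coeff w p else 0ℚ)
  if-∧ true b′ = refl
  if-∧ false b′ = QP.+-identityˡ 0ℚ

toℚ-toℕ : ∀ b → toℚ (toℕ b) ≡ (if b then 1ℚ else 0ℚ)
toℚ-toℕ true = refl
toℚ-toℕ false = refl

toℚ-toℕ-* : ∀ b n → toℚ (toℕ b * n) ≡ (if b then toℚ n else 0ℚ)
toℚ-toℕ-* true n = cong toℚ (NP.+-identityʳ n)
toℚ-toℕ-* false n = refl

coeff-word : ∀ w v → coeff w (word v) ≡ toℚ (χ (v ≟W w))
coeff-word w v rewrite toℚ-toℕ (does (v ≟W w)) = QP.+-identityʳ _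

coeff-ш : ∀ u v w → coeff w (u ш v) ≡ toℚ (shuffleCount u v w)
coeff-ш [] v w = coeff-word w v
coeff-ш (a ∷ u) [] w = coeff-word w (a ∷ u)
coeff-ш (a ∷ u) (b ∷ v) [] rewrite coeff-++ [] (a · (u ш (b ∷ v))) (b · ((a ∷ u) ш v))
  | coeff-[]-· a (u ш (b ∷ v)) | coeff-[]-· b ((a ∷ u) ш v) = refl
coeff-ш (a ∷ u) (b ∷ v) (c ∷ w) rewrite coeff-++ (c ∷ w) (a · (u ш (b ∷ v))) (b · ((a ∷ u) ш v))
  | coeff-∷-· a c w (u ш (b ∷ v)) | coeff-∷-· b c w ((a ∷ u) ш v)
  | toℚ-+ (χ (a ≟L c) * shuffleCount u (b ∷ v) w) (χ (b ≟L c) * shuffleCount (a ∷ u) v w)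
  | toℚ-toℕ-* (does (a ≟L c)) (shuffleCount u (b ∷ v) w)
  | toℚ-toℕ-* (does (b ≟L c)) (shuffleCount (a ∷ u) v w)
  | coeff-ш u (b ∷ v) w | coeff-ш (a ∷ u) v w = refl

xy-word-∷ : ∀ k ks → xy-word (k ∷ ks) ≡ replicate k x ++ (y ∷ xy-word ks)
xy-word-∷ k ks = LP.++-assoc (replicate k x) [ y ] (xy-word ks)

incHead : List ℕ → List ℕ
incHead [] = []
incHead (k ∷ α) = suc k ∷ α

exponents : Word → List ℕ
exponents [] = []
exponents (y ∷ w) = 0 ∷ exponents w
exponents (x ∷ w) = incHead (exponents w)

exponents-x^y : ∀ k w → exponents (replicate k x ++ (y ∷ w)) ≡ k ∷ exponents w
exponents-x^y zero w = refl
exponents-x^y (suc k) w rewrite exponents-x^y k w = refl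

exponents-xy-word : ∀ α → exponents (xy-word α) ≡ α
exponents-xy-word [] = refl
exponents-xy-word (k ∷ α) rewrite xy-word-∷ k α | exponents-x^y k (xy-word α) | exponents-xy-word α = refl

xy-word-injective : ∀ α β → xy-word α ≡ xy-word β → α ≡ β
xy-word-injective α β e = trans (sym (exponents-xy-word α)) (trans (cong exponents e) (exponents-xy-word β))

data EndsInY : Word → Set where
  empty : EndsInY []
  single-y : EndsInY (y ∷ [])
  cons : ∀ c {d w} → EndsInY (d ∷ w) → EndsInY (c ∷ d ∷ w)

EndsInY-tail : ∀ {a u} → EndsInY (a ∷ u) → EndsInY u
EndsInY-tail single-y = empty
EndsInY-tail (cons c e) = e

EndsInY-∷ : ∀ c {w} → EndsInY w → ¬ (w ≡ []) → EndsInY (c ∷ w)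
EndsInY-∷ c empty h = ⊥-elim (h refl)
EndsInY-∷ c single-y h = cons c single-y
EndsInY-∷ c (cons d e) h = cons c (cons d e)

EndsInY-x^y : ∀ k w → EndsInY w → EndsInY (replicate k x ++ (y ∷ w))
EndsInY-x^y zero [] e = single-y
EndsInY-x^y zero (d ∷ w) e = cons y e
EndsInY-x^y (suc k) w e = EndsInY-∷ x (EndsInY-x^y k w e) (x^y≢[] k)
  where
  x^y≢[] : ∀ k → ¬ (replicate k x ++ (y ∷ w) ≡ [])
  x^y≢[] zero ()
  x^y≢[] (suc k) ()

EndsInY-xy-word : ∀ α → EndsInY (xy-word α)
EndsInY-xy-word [] = empty
EndsInY-xy-word (k ∷ α) rewrite xy-word-∷ k α = EndsInY-x^y k (xy-word α) (EndsInY-xy-word α)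

exponents-nonempty : ∀ {d w} → EndsInY (d ∷ w) → Σ ℕ λ k → Σ (List ℕ) λ α → exponents (d ∷ w) ≡ k ∷ α
exponents-nonempty single-y = 0 , [] , refl
exponents-nonempty {y} {w} (cons .y e) = 0 , exponents w , refl
exponents-nonempty {x} (cons .x e) with exponents-nonempty e
... | k , α , eq rewrite eq = suc k , α , refl

xy-word-exponents : ∀ {w} → EndsInY w → xy-word (exponents w) ≡ w
xy-word-exponents empty = refl
xy-word-exponents single-y = refl
xy-word-exponents {y ∷ d ∷ w} (cons .y e) = cong (y ∷_) (xy-word-exponents e)
xy-word-exponents {x ∷ d ∷ w} (cons .x e) with exponents-nonempty e | xy-word-exponents e
... | k , α , eq | ih rewrite eq = trans (xy-word-∷ (suc k) α) (cong (x ∷_) (trans (sym (xy-word-∷ k α)) ih))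

count : Letter → Word → ℕ
count c [] = 0
count c (d ∷ w) = χ (d ≟L c) + count c w

count-++ : ∀ c u v → count c (u ++ v) ≡ count c u + count c v
count-++ c [] v = refl
count-++ c (d ∷ u) v rewrite count-++ c u v = sym (NP.+-assoc (χ (d ≟L c)) (count c u) (count c v))

count-y-xs : ∀ k → count y (replicate k x) ≡ 0
count-y-xs zero = refl
count-y-xs (suc k) = count-y-xs k
count-x-xs : ∀ k → count x (replicate k x) ≡ k
count-x-xs zero = refl
count-x-xs (suc k) = cong suc (count-x-xs k)

count-y-xy-word : ∀ α → count y (xy-word α) ≡ length α
count-y-xy-word [] = refl
count-y-xy-word (k ∷ α) rewrite xy-word-∷ k α | count-++ y (replicate k x) (y ∷ xy-word α) | count-y-xs k | count-y-xy-word α = refl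

count-x-xy-word : ∀ α → count x (xy-word α) ≡ sum α
count-x-xy-word [] = refl
count-x-xy-word (k ∷ α) rewrite xy-word-∷ k α | count-++ x (replicate k x) (y ∷ xy-word α) | count-x-xs k | count-x-xy-word α = refl

data Shuffle : Word → Word → Word → Set where
  []ˡ  : ∀ {v} → Shuffle [] v v
  []ʳ  : ∀ {u} → Shuffle u [] u
  _∷ˡ_ : ∀ a {u b v w} → Shuffle u (b ∷ v) w → Shuffle (a ∷ u) (b ∷ v) (a ∷ w)
  _∷ʳ_ : ∀ b {a u v w} → Shuffle (a ∷ u) v w → Shuffle (a ∷ u) (b ∷ v) (b ∷ w)

shuffleCount≢0⇒Shuffle : ∀ u v w → shuffleCount u v w ≢ 0 → Shuffle u v w
shuffleCount≢0⇒Shuffle [] v w h with refl ← χ≢0 (v ≟W w) h = []ˡ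
shuffleCount≢0⇒Shuffle (a ∷ u) [] w h with refl ← χ≢0 ((a ∷ u) ≟W w) h = []ʳ
shuffleCount≢0⇒Shuffle (a ∷ u) (b ∷ v) [] h = ⊥-elim (h refl)
shuffleCount≢0⇒Shuffle (a ∷ u) (b ∷ v) (c ∷ w) h
  with m+n≢0⇒m≢0⊎n≢0 (χ (a ≟L c) * shuffleCount u (b ∷ v) w) _ h
... | inj₁ h₁ with refl , h₁′ ← χ-*≢0 (a ≟L c) h₁ = a ∷ˡ shuffleCount≢0⇒Shuffle u (b ∷ v) w h₁′
... | inj₂ h₂ with refl , h₂′ ← χ-*≢0 (b ≟L c) h₂ = b ∷ʳ shuffleCount≢0⇒Shuffle (a ∷ u) v w h₂′

Shuffle-count : ∀ c {u v w} → Shuffle u v w → count c w ≡ count c u + count c v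
Shuffle-count c []ˡ = refl
Shuffle-count c []ʳ = sym (NP.+-identityʳ _)
Shuffle-count c (a ∷ˡ s) = trans (cong (χ (a ≟L c) +_) (Shuffle-count c s)) (sym (NP.+-assoc (χ (a ≟L c)) _ _))
Shuffle-count c (_∷ʳ_ b {a} {u} {v} s) =
  trans (cong (χ (b ≟L c) +_) (Shuffle-count c s)) (m+[n+o]≡n+[m+o] (χ (b ≟L c)) (count c (a ∷ u)) (count c v))

Shuffle-≢[]ˡ : ∀ {a u v w} → Shuffle (a ∷ u) v w → w ≢ []
Shuffle-≢[]ˡ []ʳ ()
Shuffle-≢[]ˡ (_ ∷ˡ _) ()
Shuffle-≢[]ˡ (_ ∷ʳ _) ()

Shuffle-≢[]ʳ : ∀ {u b v w} → Shuffle u (b ∷ v) w → w ≢ []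
Shuffle-≢[]ʳ []ˡ ()
Shuffle-≢[]ʳ (_ ∷ˡ _) ()
Shuffle-≢[]ʳ (_ ∷ʳ _) ()

Shuffle-EndsInY : ∀ {u v w} → Shuffle u v w → EndsInY u → EndsInY v → EndsInY w
Shuffle-EndsInY []ˡ eu ev = ev
Shuffle-EndsInY []ʳ eu ev = eu
Shuffle-EndsInY (a ∷ˡ s) eu ev = EndsInY-∷ a (Shuffle-EndsInY s (EndsInY-tail eu) ev) (Shuffle-≢[]ʳ s)
Shuffle-EndsInY (b ∷ʳ s) eu ev = EndsInY-∷ b (Shuffle-EndsInY s eu (EndsInY-tail ev)) (Shuffle-≢[]ˡ s)


sumOver : ∀ {A : Set} → (A → ℕ) → List A → ℕ
sumOver f [] = 0
sumOver f (a ∷ L) = f a + sumOver f L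

sumOver-++ : ∀ {A : Set} (f : A → ℕ) L M → sumOver f (L ++ M) ≡ sumOver f L + sumOver f M
sumOver-++ f [] M = refl
sumOver-++ f (a ∷ L) M rewrite sumOver-++ f L M = sym (NP.+-assoc (f a) (sumOver f L) (sumOver f M))

sumOver-map : ∀ {A B : Set} (f : B → ℕ) (g : A → B) L → sumOver f (map g L) ≡ sumOver (λ a → f (g a)) L
sumOver-map f g [] = refl
sumOver-map f g (a ∷ L) = cong (f (g a) +_) (sumOver-map f g L)

sumOver-concatMap : ∀ {A B : Set} (f : B → ℕ) (g : A → List B) L →
  sumOver f (concatMap g L) ≡ sumOver (λ a → sumOver f (g a)) L
sumOver-concatMap f g [] = refl
sumOver-concatMap f g (a ∷ L) =
  trans (sumOver-++ f (g a) (concatMap g L)) (cong (sumOver f (g a) +_) (sumOver-concatMap f g L))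

sumOver-cong : ∀ {A : Set} {f g : A → ℕ} L → (∀ a → f a ≡ g a) → sumOver f L ≡ sumOver g L
sumOver-cong [] h = refl
sumOver-cong (a ∷ L) h = cong₂ _+_ (h a) (sumOver-cong L h)

sumOver-zero : ∀ {A : Set} {f : A → ℕ} L → (∀ a → f a ≡ 0) → sumOver f L ≡ 0
sumOver-zero [] h = refl
sumOver-zero (a ∷ L) h rewrite h a = sumOver-zero L h

sumOver-*ˡ : ∀ {A : Set} (c : ℕ) (f : A → ℕ) L → sumOver (λ a → c * f a) L ≡ c * sumOver f L
sumOver-*ˡ c f [] = sym (NP.*-zeroʳ c)
sumOver-*ˡ c f (a ∷ L) rewrite sumOver-*ˡ c f L = sym (NP.*-distribˡ-+ c (f a) (sumOver f L))

sumOver-filter : ∀ {A : Set} {p} {P : Pred A p} (P? : Decidable P) (f : A → ℕ) L →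
  sumOver f (filter P? L) ≡ sumOver (λ a → χ (P? a) * f a) L
sumOver-filter P? f [] = refl
sumOver-filter P? f (a ∷ L) with does (P? a)
... | true = cong₂ _+_ (sym (NP.+-identityʳ (f a))) (sumOver-filter P? f L)
... | false = sumOver-filter P? f L

sumBelow : ℕ → (ℕ → ℕ) → ℕ
sumBelow zero f = 0
sumBelow (suc m) f = sumBelow m f + f m

sumOver-applyUpTo : ∀ (f : ℕ → ℕ) (g : ℕ → ℕ) m → sumOver f (applyUpTo g m) ≡ sumBelow m (λ i → f (g i))
sumOver-applyUpTo f g zero = refl
sumOver-applyUpTo f g (suc m) = begin
  sumOver f (applyUpTo g (suc m))            ≡⟨ cong (sumOver f) (sym (LP.applyUpTo-∷ʳ g m)) ⟩
  sumOver f (applyUpTo g m ++ [ g m ])       ≡⟨ sumOver-++ f (applyUpTo g m) [ g m ] ⟩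
  sumOver f (applyUpTo g m) + (f (g m) + 0)  ≡⟨ cong₂ _+_ (sumOver-applyUpTo f g m) (NP.+-identityʳ _) ⟩
  sumBelow m (λ i → f (g i)) + f (g m)       ∎
  where open ≡-Reasoning

sumOver-upTo : ∀ (f : ℕ → ℕ) m → sumOver f (upTo m) ≡ sumBelow m f
sumOver-upTo f m = sumOver-applyUpTo f (λ i → i) m

sumBelow-cong : ∀ m {f g : ℕ → ℕ} → (∀ i → i < m → f i ≡ g i) → sumBelow m f ≡ sumBelow m g
sumBelow-cong zero h = refl
sumBelow-cong (suc m) h = cong₂ _+_ (sumBelow-cong m (λ i i<m → h i (NP.m<n⇒m<1+n i<m))) (h m NP.≤-refl)

sumBelow-zero : ∀ m {f : ℕ → ℕ} → (∀ i → i < m → f i ≡ 0) → sumBelow m f ≡ 0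
sumBelow-zero zero h = refl
sumBelow-zero (suc m) h = cong₂ _+_ (sumBelow-zero m (λ i i<m → h i (NP.m<n⇒m<1+n i<m))) (h m NP.≤-refl)

eqℕ : ℕ → ℕ → ℕ
eqℕ a b = χ (a ℕ.≟ b)

eqList : List ℕ → List ℕ → ℕ
eqList a b = χ (LP.≡-dec ℕ._≟_ a b)

eqℕ-≢ : ∀ a b → a ≢ b → eqℕ a b ≡ 0
eqℕ-≢ a b = χ-no (a ℕ.≟ b)

eqList-∷ : ∀ e c α β → eqList (e ∷ α) (c ∷ β) ≡ eqℕ e c * eqList α β
eqList-∷ e c α β = toℕ-∧ (does (e ℕ.≟ c)) (does (LP.≡-dec ℕ._≟_ α β))

sumBelow-select : ∀ m c (g : ℕ → ℕ) → c < m → sumBelow m (λ e → eqℕ e c * g e) ≡ g c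
sumBelow-select zero c g ()
sumBelow-select (suc m) c g c<1+m with NP.m≤n⇒m<n∨m≡n (NP.≤-pred c<1+m)
... | inj₁ c<m rewrite sumBelow-select m c g c<m | eqℕ-≢ m c (λ e → NP.<-irrefl (sym e) c<m) =
  NP.+-identityʳ (g c)
... | inj₂ refl rewrite χ-yes (c ℕ.≟ c) refl =
  trans (cong (_+ (g c + 0)) (sumBelow-zero c (λ i i<c → cong (_* g i) (eqℕ-≢ i c (NP.<⇒≢ i<c)))))
        (NP.+-identityʳ (g c))

sumOver-allLists-suc : ∀ k R (g : List ℕ → ℕ) →
  sumOver g (allLists (suc k) R) ≡ sumOver (λ e → sumOver (λ α → g (e ∷ α)) (allLists k R)) R
sumOver-allLists-suc k R g =
  trans (sumOver-concatMap g (λ e → map (e ∷_) (allLists k R)) R)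
        (sumOver-cong R (λ e → sumOver-map g (e ∷_) (allLists k R)))

sumOver-eqList-∷ : ∀ e c γ (f : List ℕ → ℕ) L →
  sumOver (λ α → eqList (e ∷ α) (c ∷ γ) * f (e ∷ α)) L ≡ eqℕ e c * sumOver (λ α → eqList α γ * f (e ∷ α)) L
sumOver-eqList-∷ e c γ f L =
  trans (sumOver-cong L (λ α → trans (cong (_* f (e ∷ α)) (eqList-∷ e c α γ)) (NP.*-assoc (eqℕ e c) _ _)))
        (sumOver-*ˡ (eqℕ e c) _ L)

sumOver-allLists-select : ∀ k m γ (f : List ℕ → ℕ) → length γ ≡ k → All (_< m) γ →
  sumOver (λ α → eqList α γ * f α) (allLists k (upTo m)) ≡ f γ
sumOver-allLists-select zero m [] f refl [] = trans (NP.+-identityʳ _) (NP.*-identityˡ (f []))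
sumOver-allLists-select (suc k) m (c ∷ γ) f refl (c<m ∷ γ<m) = begin
  sumOver (λ α → eqList α (c ∷ γ) * f α) (allLists (suc k) (upTo m))
    ≡⟨ sumOver-allLists-suc k (upTo m) _ ⟩
  sumOver (λ e → sumOver (λ α → eqList (e ∷ α) (c ∷ γ) * f (e ∷ α)) (allLists k (upTo m))) (upTo m)
    ≡⟨ sumOver-cong (upTo m) (λ e → trans (sumOver-eqList-∷ e c γ f (allLists k (upTo m)))
         (cong (eqℕ e c *_) (sumOver-allLists-select k m γ (λ α → f (e ∷ α)) refl γ<m))) ⟩
  sumOver (λ e → eqℕ e c * f (e ∷ γ)) (upTo m)
    ≡⟨ sumOver-upTo _ m ⟩
  sumBelow m (λ e → eqℕ e c * f (e ∷ γ))
    ≡⟨ sumBelow-select m c (λ e → f (e ∷ γ)) c<m ⟩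
  f (c ∷ γ) ∎
  where open ≡-Reasoning

sumOver-allLists-length≢ : ∀ k m γ (f : List ℕ → ℕ) → length γ ≢ k →
  sumOver (λ α → eqList α γ * f α) (allLists k (upTo m)) ≡ 0
sumOver-allLists-length≢ zero m [] f h = ⊥-elim (h refl)
sumOver-allLists-length≢ zero m (c ∷ γ) f h = refl
sumOver-allLists-length≢ (suc k) m [] f h =
  trans (sumOver-allLists-suc k (upTo m) _) (sumOver-zero (upTo m) (λ e → sumOver-zero (allLists k (upTo m)) (λ α → refl)))
sumOver-allLists-length≢ (suc k) m (c ∷ γ) f h =
  trans (sumOver-allLists-suc k (upTo m) _) (sumOver-zero (upTo m) (λ e →
    trans (sumOver-eqList-∷ e c γ f (allLists k (upTo m)))
          (trans (cong (eqℕ e c *_) (sumOver-allLists-length≢ k m γ (λ α → f (e ∷ α)) (λ q → h (cong suc q))))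
                 (NP.*-zeroʳ (eqℕ e c)))))

All<1+sum : ∀ α → All (_< suc (sum α)) α
All<1+sum [] = []
All<1+sum (k ∷ α) =
  s≤s (NP.m≤m+n k (sum α)) ∷ All.map (λ i<1+Σ → NP.≤-trans i<1+Σ (s≤s (NP.m≤n+m (sum α) k))) (All<1+sum α)

sumOver-weakCompositions : ∀ k n γ (c : List ℕ → ℕ) →
  sumOver (λ α → χ (xy-word α ≟W xy-word γ) * c α) (weakCompositions k n)
  ≡ χ (length γ ℕ.≟ k) * (χ (sum γ ℕ.≟ n) * c γ)
sumOver-weakCompositions k n γ c = begin
  sumOver (λ α → χ (xy-word α ≟W xy-word γ) * c α) (weakCompositions k n)
    ≡⟨ sumOver-filter (λ α → sum α ℕ.≟ n) _ (allLists k (upTo (suc n))) ⟩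
  sumOver (λ α → χ (sum α ℕ.≟ n) * (χ (xy-word α ≟W xy-word γ) * c α)) (allLists k (upTo (suc n)))
    ≡⟨ sumOver-cong (allLists k (upTo (suc n))) reorder ⟩
  sumOver (λ α → eqList α γ * F α) (allLists k (upTo (suc n)))
    ≡⟨ select (length γ ℕ.≟ k) (sum γ ℕ.≟ n) ⟩
  χ (length γ ℕ.≟ k) * (χ (sum γ ℕ.≟ n) * c γ) ∎
  where
  open ≡-Reasoning
  F : List ℕ → ℕ
  F α = χ (sum α ℕ.≟ n) * c α
  reorder : ∀ α → χ (sum α ℕ.≟ n) * (χ (xy-word α ≟W xy-word γ) * c α) ≡ eqList α γ * F α
  reorder α =
    trans (cong (λ b → χ (sum α ℕ.≟ n) * (toℕ b * c α))
                (does-⇔ (mk⇔ (xy-word-injective α γ) (cong xy-word)) (xy-word α ≟W xy-word γ) (LP.≡-dec ℕ._≟_ α γ)))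
          (m*[n*o]≡n*[m*o] (χ (sum α ℕ.≟ n)) (eqList α γ) (c α))
  select : (l? : Dec (length γ ≡ k)) (σ? : Dec (sum γ ≡ n)) →
    sumOver (λ α → eqList α γ * F α) (allLists k (upTo (suc n))) ≡ χ l? * F γ
  select (yes l) (yes σ) =
    trans (sumOver-allLists-select k (suc n) γ F l (subst (λ m → All (_< suc m) γ) σ (All<1+sum γ)))
          (sym (NP.+-identityʳ _))
  select (yes l) (no ¬σ) =
    trans (sumOver-zero (allLists k (upTo (suc n))) vanish) (sym (cong (λ z → 1 * (z * c γ)) (χ-no (sum γ ℕ.≟ n) ¬σ)))
    where
    vanish : ∀ α → eqList α γ * F α ≡ 0
    vanish α with LP.≡-dec ℕ._≟_ α γ
    ... | yes refl rewrite χ-no (sum γ ℕ.≟ n) ¬σ = refl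
    ... | no _ = refl
  select (no ¬l) σ? = sumOver-allLists-length≢ k (suc n) γ F ¬l

coeff-xy-combination : ∀ w (c : List ℕ → ℕ) L →
  coeff w (map (λ α → ((ℤ.+ c α) ℚ./ 1 , xy-word α)) L) ≡ toℚ (sumOver (λ α → χ (xy-word α ≟W w) * c α) L)
coeff-xy-combination w c [] = refl
coeff-xy-combination w c (α ∷ L) =
  trans (cong₂ ℚ._+_ (sym (toℚ-toℕ-* (does (xy-word α ≟W w)) (c α))) (coeff-xy-combination w c L))
        (sym (toℚ-+ (χ (xy-word α ≟W w) * c α) _))

module _ (as bs : List ℕ) where

  Shuffle-xy-word-exponents : ∀ {w} → Shuffle (xy-word as) (xy-word bs) w → xy-word (exponents w) ≡ w
  Shuffle-xy-word-exponents s = xy-word-exponents (Shuffle-EndsInY s (EndsInY-xy-word as) (EndsInY-xy-word bs))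

  Shuffle-xy-word-length : ∀ γ → Shuffle (xy-word as) (xy-word bs) (xy-word γ) → length γ ≡ length as + length bs
  Shuffle-xy-word-length γ s =
    trans (sym (count-y-xy-word γ)) (trans (Shuffle-count y s) (cong₂ _+_ (count-y-xy-word as) (count-y-xy-word bs)))

  Shuffle-xy-word-sum : ∀ γ → Shuffle (xy-word as) (xy-word bs) (xy-word γ) → sum γ ≡ sum as + sum bs
  Shuffle-xy-word-sum γ s =
    trans (sym (count-x-xy-word γ)) (trans (Shuffle-count x s) (cong₂ _+_ (count-x-xy-word as) (count-x-xy-word bs)))

  shuffleCount-vanishes : ∀ w → ¬ Shuffle (xy-word as) (xy-word bs) w → shuffleCount (xy-word as) (xy-word bs) w ≡ 0
  shuffleCount-vanishes w ¬s =
    decidable-stable (_ ℕ.≟ 0) (λ h → ¬s (shuffleCount≢0⇒Shuffle (xy-word as) (xy-word bs) w h))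

  module _ (r s : ℕ) (las : length as ≡ r) (lbs : length bs ≡ s)
           (on-support : ∀ γ → length γ ≡ r + s → sum γ ≡ sum as + sum bs →
                         shuffleCount (xy-word as) (xy-word bs) (xy-word γ) ≡ cCoeff r s as bs γ) where

    shuffleCount-xy-word : ∀ γ (l? : Dec (length γ ≡ r + s)) (σ? : Dec (sum γ ≡ sum as + sum bs)) →
      shuffleCount (xy-word as) (xy-word bs) (xy-word γ) ≡ χ l? * (χ σ? * cCoeff r s as bs γ)
    shuffleCount-xy-word γ (yes l) (yes σ) = trans (on-support γ l σ) (sym (trans (NP.+-identityʳ _) (NP.+-identityʳ _)))
    shuffleCount-xy-word γ (yes _) (no ¬σ) = shuffleCount-vanishes (xy-word γ) (λ sh → ¬σ (Shuffle-xy-word-sum γ sh))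
    shuffleCount-xy-word γ (no ¬l) _ = shuffleCount-vanishes (xy-word γ) (λ sh →
      ¬l (trans (Shuffle-xy-word-length γ sh) (cong₂ _+_ las lbs)))

    shuffleCount≡coefficientSum : ∀ w → shuffleCount (xy-word as) (xy-word bs) w
      ≡ sumOver (λ α → χ (xy-word α ≟W w) * cCoeff r s as bs α) (weakCompositions (r + s) (sum as + sum bs))
    shuffleCount≡coefficientSum w with w ≟W xy-word (exponents w)
    ... | yes w≡ =
      subst (λ v → shuffleCount (xy-word as) (xy-word bs) v
                   ≡ sumOver (λ α → χ (xy-word α ≟W v) * cCoeff r s as bs α) (weakCompositions (r + s) (sum as + sum bs)))
            (sym w≡)
            (trans (shuffleCount-xy-word (exponents w) (_ ℕ.≟ _) (_ ℕ.≟ _))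
                   (sym (sumOver-weakCompositions (r + s) (sum as + sum bs) (exponents w) (cCoeff r s as bs))))
    ... | no w≢ =
      trans (shuffleCount-vanishes w (λ sh → w≢ (sym (Shuffle-xy-word-exponents sh))))
            (sym (sumOver-zero (weakCompositions (r + s) (sum as + sum bs)) (λ α →
              cong (_* cCoeff r s as bs α) (χ-no (xy-word α ≟W w) (λ e → w≢ (not-xy {α} e))))))
      where
      not-xy : ∀ {α} → xy-word α ≡ w → w ≡ xy-word (exponents w)
      not-xy {α} refl = cong xy-word (sym (exponents-xy-word α))

    ≈𝔥-rhs : (xy-word as ш xy-word bs) ≈𝔥 rhs r s as bs
    ≈𝔥-rhs w = begin
      coeff w (xy-word as ш xy-word bs)  ≡⟨ coeff-ш (xy-word as) (xy-word bs) w ⟩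
      toℚ (shuffleCount (xy-word as) (xy-word bs) w)  ≡⟨ cong toℚ (shuffleCount≡coefficientSum w) ⟩
      toℚ (sumOver _ (weakCompositions (r + s) (sum as + sum bs)))
        ≡⟨ sym (coeff-xy-combination w (cCoeff r s as bs) (weakCompositions (r + s) (sum as + sum bs))) ⟩
      coeff w (rhs r s as bs) ∎
      where open ≡-Reasoning


-- The shuffle recurrence on exponents

-- Unlike _≤ᵇ_, leq recurses on both arguments, so leq (suc k) (suc n) reduces to leq k n.
leq : ℕ → ℕ → Bool
leq zero n = true
leq (suc k) zero = false
leq (suc k) (suc n) = leq k n

leq-sound : ∀ k n → leq k n ≡ true → k ≤ n
leq-sound zero n e = z≤n
leq-sound (suc k) (suc n) e = s≤s (leq-sound k n e)

leq-complete : ∀ k n → k ≤ n → leq k n ≡ true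
leq-complete zero n h = refl
leq-complete (suc k) (suc n) (s≤s h) = leq-complete k n h

leq-false : ∀ k n → n < k → leq k n ≡ false
leq-false (suc k) zero n<k = refl
leq-false (suc k) (suc n) (s≤s n<k) = leq-false k n n<k

ind≤ : ℕ → ℕ → ℕ
ind≤ k n = toℕ (leq k n)

ind≤-*-cong : ∀ k n {a b : ℕ} → (k ≤ n → a ≡ b) → ind≤ k n * a ≡ ind≤ k n * b
ind≤-*-cong k n h with leq k n in eq
... | true = cong (_+ 0) (h (leq-sound k n eq))
... | false = refl

C-suc-suc : ∀ k i → k ≤ i → suc k C suc i ≡ k C i
C-suc-suc k i k≤i with NP.m≤n⇒m<n∨m≡n k≤i
... | inj₁ k<i = trans (k>n⇒nCk≡0 (s≤s k<i)) (sym (k>n⇒nCk≡0 k<i))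
... | inj₂ refl = trans (nCn≡1 (suc k)) (sym (nCn≡1 k))

x^y : ℕ → Word → Word
x^y i U = replicate i x ++ (y ∷ U)

shuffleCount-x^y : ∀ k i j U V W →
  shuffleCount (x^y i U) (x^y j V) (x^y k W) ≡
  ind≤ k (i + j) * ((k C i) * shuffleCount U (x^y (i + j ∸ k) V) W + (k C j) * shuffleCount (x^y (i + j ∸ k) U) V W)
shuffleCount-x^y zero zero zero U V W = sym (NP.+-identityʳ _)
shuffleCount-x^y zero (suc i) zero U V W rewrite NP.+-identityʳ i = sym (NP.+-identityʳ _)
shuffleCount-x^y zero zero (suc j) U V W = sym (NP.+-identityʳ _)
shuffleCount-x^y zero (suc i) (suc j) U V W = refl
shuffleCount-x^y (suc k) zero zero U V W = refl
shuffleCount-x^y (suc k) (suc i) zero U V W rewrite shuffleCount-x^y k i zero U V W | NP.+-identityʳ i =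
  trans (trans (NP.+-identityʳ _) (NP.+-identityʳ _))
        (ind≤-*-cong k i (λ k≤i → cong (λ c → c * shuffleCount U (x^y (i ∸ k) V) W + (k C 0) * shuffleCount
            (x^y (i ∸ k) U) V W) (sym (C-suc-suc k i k≤i))))
shuffleCount-x^y (suc k) zero (suc j) U V W =
  trans (NP.+-identityʳ _)
        (trans (shuffleCount-x^y k zero j U V W)
               (ind≤-*-cong k j (λ k≤j → cong (λ c → (k C 0) * shuffleCount U (x^y (j ∸ k) V) W + c * shuffleCount
                   (x^y (j ∸ k) U) V W) (sym (C-suc-suc k j k≤j)))))
shuffleCount-x^y (suc k) (suc i) (suc j) U V W
  rewrite NP.+-suc i j | shuffleCount-x^y k i (suc j) U V W | shuffleCount-x^y k (suc i) j U V W | NP.+-suc i j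
        | sym (nCk+nC[k+1]≡[n+1]C[k+1] k i) | sym (nCk+nC[k+1]≡[n+1]C[k+1] k j) =
  NS.+-*-Solver.solve 7
    (λ g a b a′ b′ c₁ c₂ → (con 1 :* (g :* (a :* c₁ :+ b :* c₂))) :+ (con 1 :* (g :* (a′ :* c₁ :+ b′ :* c₂)))
                        := g :* ((a :+ a′) :* c₁ :+ (b′ :+ b) :* c₂))
    refl (ind≤ k (suc (i + j))) (k C i) (k C suc j) (k C suc i) (k C j)
    (shuffleCount U (x^y (suc (i + j) ∸ k) V) W) (shuffleCount (x^y (suc (i + j) ∸ k) U) V W)
  where open NS.+-*-Solver using (_:+_; _:*_; _:=_; con)


toℤ : ℕ → ℤ
toℤ n = ℤ.+ n

rest : ℤ → ℤ → ℕ → ℤ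
rest i j k = (i ℤ.+ j) ℤ.- ℤ.+ k

eqℤs : List ℤ → List ℤ → ℕ
eqℤs u w = χ (LP.≡-dec ℤ._≟_ u w)

eqℤs-≢ : ∀ u w → u ≢ w → eqℤs u w ≡ 0
eqℤs-≢ u w = χ-no (LP.≡-dec ℤ._≟_ u w)

-- A negative leading exponent marks an impossible state; binom vanishes there, which absorbs
-- the indicator ind≤ k (i + j) of shuffleCount-x^y.
shuffleCountℤ : List ℤ → List ℤ → List ℕ → ℕ
shuffleCountℤ [] v α = eqℤs v (map toℤ α)
shuffleCountℤ (i ∷ u) [] α = eqℤs (i ∷ u) (map toℤ α)
shuffleCountℤ (i ∷ u) (j ∷ v) [] = 0
shuffleCountℤ (i ∷ u) (j ∷ v) (k ∷ α) =
  binom k i * shuffleCountℤ u (rest i j k ∷ v) α + binom k j * shuffleCountℤ (rest i j k ∷ u) v α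

rest-comm : ∀ i j k → rest i j k ≡ rest j i k
rest-comm i j k = cong (ℤ._- ℤ.+ k) (ZP.+-comm i j)

shuffleCountℤ-comm : ∀ α u v → shuffleCountℤ u v α ≡ shuffleCountℤ v u α
shuffleCountℤ-comm α [] [] = refl
shuffleCountℤ-comm α [] (j ∷ v) = refl
shuffleCountℤ-comm α (i ∷ u) [] = refl
shuffleCountℤ-comm [] (i ∷ u) (j ∷ v) = refl
shuffleCountℤ-comm (k ∷ α) (i ∷ u) (j ∷ v)
  rewrite rest-comm j i k | shuffleCountℤ-comm α u (rest i j k ∷ v) | shuffleCountℤ-comm α (rest i j k ∷ u) v =
  NP.+-comm (binom k i * shuffleCountℤ (rest i j k ∷ v) u α) _

rest-negative : ∀ m n k → m ≤ k → rest (ℤ.+ m) -[1+ n ] k ≡ -[1+ (n + (k ∸ m)) ]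
rest-negative m n k m≤k = begin
  rest (ℤ.+ m) -[1+ n ] k          ≡⟨ cong (rest (ℤ.+ m) -[1+ n ]) (sym (NP.m+[n∸m]≡n m≤k)) ⟩
  rest (ℤ.+ m) -[1+ n ] (m + d)    ≡⟨ ZS.+-*-Solver.solve 3 (λ M N D → (M :+ (:- (con (ℤ.+ 1) :+ N))) :- (M :+ D)
                                                                  := :- (con (ℤ.+ 1) :+ (N :+ D))) refl (ℤ.+ m) (ℤ.+ n) (ℤ.+ d) ⟩
  -[1+ (n + d) ]                   ∎
  where
  open ≡-Reasoning
  open ZS.+-*-Solver using (_:+_; _:-_; :-_; _:=_; con)
  d = k ∸ m

shuffleCountℤ-negativeʳ : ∀ α u n v → shuffleCountℤ u (-[1+ n ] ∷ v) α ≡ 0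
shuffleCountℤ-negativeʳ α [] n v = eqℤs-≢ (-[1+ n ] ∷ v) (map toℤ α) (not-nat α)
  where
  not-nat : ∀ α → -[1+ n ] ∷ v ≢ map toℤ α
  not-nat [] ()
  not-nat (k ∷ α) ()
shuffleCountℤ-negativeʳ [] (i ∷ u) n v = refl
shuffleCountℤ-negativeʳ (k ∷ α) (-[1+ m ] ∷ u) n v = refl
shuffleCountℤ-negativeʳ (k ∷ α) (ℤ.+ m ∷ u) n v with m ℕ.≤? k
... | yes m≤k rewrite rest-negative m n k m≤k | shuffleCountℤ-negativeʳ α u (n + (k ∸ m)) v =
  trans (NP.+-identityʳ _) (NP.*-zeroʳ (k C m))
... | no m≰k rewrite k>n⇒nCk≡0 (NP.≰⇒> m≰k) = refl

shuffleCountℤ-negativeˡ : ∀ α n u v → shuffleCountℤ (-[1+ n ] ∷ u) v α ≡ 0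
shuffleCountℤ-negativeˡ α n u v = trans (shuffleCountℤ-comm α (-[1+ n ] ∷ u) v) (shuffleCountℤ-negativeʳ α v n u)

+m-+k≡+[m∸k] : ∀ m k → k ≤ m → ℤ.+ m ℤ.- ℤ.+ k ≡ ℤ.+ (m ∸ k)
+m-+k≡+[m∸k] m k k≤m = trans (ZP.m-n≡m⊖n m k) (ZP.⊖-≥ k≤m)

+m-+k<0 : ∀ m k → m < k → Σ ℕ (λ n → ℤ.+ m ℤ.- ℤ.+ k ≡ -[1+ n ])
+m-+k<0 m (suc k) (s≤s m≤k) =
  k ∸ m , trans (ZP.m-n≡m⊖n m (suc k)) (trans (ZP.⊖-≤ (NP.m≤n⇒m≤1+n m≤k)) (cong (λ z → ℤ.- ℤ.+ z) (NP.+-∸-assoc 1 m≤k)))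

xy-word-nonempty : ∀ i a → Σ Letter (λ c → Σ Word (λ u → xy-word (i ∷ a) ≡ c ∷ u))
xy-word-nonempty zero a = y , xy-word a , refl
xy-word-nonempty (suc i) a = x , _ , refl

map-+-injective : ∀ a b → map toℤ a ≡ map toℤ b → a ≡ b
map-+-injective a b = LP.map-injective ZP.+-injective

shuffleCount-[]ʳ : ∀ u w → shuffleCount u [] w ≡ χ (u ≟W w)
shuffleCount-[]ʳ [] w = refl
shuffleCount-[]ʳ (a ∷ u) w = refl

χ-xy-word≟ : ∀ a α → χ (xy-word a ≟W xy-word α) ≡ eqℤs (map toℤ a) (map toℤ α)
χ-xy-word≟ a α =
  cong toℕ (does-⇔ (mk⇔ (λ e → cong (map toℤ) (xy-word-injective a α e)) (λ e → cong xy-word (map-+-injective a α e)))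
                   (xy-word a ≟W xy-word α) (LP.≡-dec ℤ._≟_ (map toℤ a) (map toℤ α)))

ind≤-rest : ∀ i j k α a b →
  ind≤ k (i + j) * ((k C i) * shuffleCountℤ (map toℤ a) (ℤ.+ (i + j ∸ k) ∷ map toℤ b) α
                  + (k C j) * shuffleCountℤ (ℤ.+ (i + j ∸ k) ∷ map toℤ a) (map toℤ b) α)
  ≡ (k C i) * shuffleCountℤ (map toℤ a) (rest (ℤ.+ i) (ℤ.+ j) k ∷ map toℤ b) α
  + (k C j) * shuffleCountℤ (rest (ℤ.+ i) (ℤ.+ j) k ∷ map toℤ a) (map toℤ b) α
ind≤-rest i j k α a b with leq k (i + j) in eq
... | true rewrite +m-+k≡+[m∸k] (i + j) k (leq-sound k (i + j) eq) = NP.+-identityʳ _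
... | false with +m-+k<0 (i + j) k (NP.≰⇒> (λ k≤i+j → case trans (sym (leq-complete k (i + j) k≤i+j)) eq of λ ()))
... | n , eqₙ rewrite eqₙ | shuffleCountℤ-negativeʳ α (map toℤ a) n (map toℤ b)
                        | shuffleCountℤ-negativeˡ α n (map toℤ a) (map toℤ b) =
  sym (cong₂ _+_ (NP.*-zeroʳ (k C i)) (NP.*-zeroʳ (k C j)))

shuffleCount≡shuffleCountℤ : ∀ α a b →
  shuffleCount (xy-word a) (xy-word b) (xy-word α) ≡ shuffleCountℤ (map toℤ a) (map toℤ b) α
shuffleCount≡shuffleCountℤ α [] b = χ-xy-word≟ b α
shuffleCount≡shuffleCountℤ α (i ∷ a) [] = trans (shuffleCount-[]ʳ (xy-word (i ∷ a)) (xy-word α)) (χ-xy-word≟ (i ∷ a) α)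
shuffleCount≡shuffleCountℤ [] (i ∷ a) (j ∷ b) with xy-word-nonempty i a | xy-word-nonempty j b
... | c , u , e₁ | d , v , e₂ rewrite e₁ | e₂ = refl
shuffleCount≡shuffleCountℤ (k ∷ α) (i ∷ a) (j ∷ b) = begin
  shuffleCount (xy-word (i ∷ a)) (xy-word (j ∷ b)) (xy-word (k ∷ α))
    ≡⟨ cong₂ (λ u v → shuffleCount u v (xy-word (k ∷ α))) (xy-word-∷ i a) (xy-word-∷ j b) ⟩
  shuffleCount (x^y i (xy-word a)) (x^y j (xy-word b)) (xy-word (k ∷ α))
    ≡⟨ cong (shuffleCount (x^y i (xy-word a)) (x^y j (xy-word b))) (xy-word-∷ k α) ⟩
  shuffleCount (x^y i (xy-word a)) (x^y j (xy-word b)) (x^y k (xy-word α))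
    ≡⟨ shuffleCount-x^y k i j (xy-word a) (xy-word b) (xy-word α) ⟩
  ind≤ k (i + j) * ((k C i) * shuffleCount (xy-word a) (x^y m (xy-word b)) (xy-word α)
                  + (k C j) * shuffleCount (x^y m (xy-word a)) (xy-word b) (xy-word α))
    ≡⟨ cong (λ z → ind≤ k (i + j) * z) (cong₂ _+_ (cong ((k C i) *_) recʳ) (cong ((k C j) *_) recˡ)) ⟩
  ind≤ k (i + j) * ((k C i) * shuffleCountℤ (map toℤ a) (ℤ.+ m ∷ map toℤ b) α
                  + (k C j) * shuffleCountℤ (ℤ.+ m ∷ map toℤ a) (map toℤ b) α)
    ≡⟨ ind≤-rest i j k α a b ⟩
  shuffleCountℤ (map toℤ (i ∷ a)) (map toℤ (j ∷ b)) (k ∷ α) ∎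
  where
  open ≡-Reasoning
  m = i + j ∸ k
  recʳ : shuffleCount (xy-word a) (x^y m (xy-word b)) (xy-word α) ≡ shuffleCountℤ (map toℤ a) (ℤ.+ m ∷ map toℤ b) α
  recʳ = trans (cong (λ v → shuffleCount (xy-word a) v (xy-word α)) (sym (xy-word-∷ m b))) (shuffleCount≡shuffleCountℤ α a (m ∷ b))
  recˡ : shuffleCount (x^y m (xy-word a)) (xy-word b) (xy-word α) ≡ shuffleCountℤ (ℤ.+ m ∷ map toℤ a) (map toℤ b) α
  recˡ = trans (cong (λ u → shuffleCount u (xy-word b) (xy-word α)) (sym (xy-word-∷ m a))) (shuffleCount≡shuffleCountℤ α (m ∷ a) b)


-- Sums over compositions and the block expansion

bumpHead : (List ℕ → ℕ) → List ℕ → ℕ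
bumpHead f [] = 0
bumpHead f (l ∷ ls) = f (suc l ∷ ls)

-- A composition of n + 1 is either 1 followed by a composition of n,
-- or a nonempty composition of n with its first part increased.
sumComp : ℕ → (List ℕ → ℕ) → ℕ
sumComp zero f = f []
sumComp (suc n) f = sumComp n (λ ls → f (1 ∷ ls)) + sumComp n (bumpHead f)

sumComp-cong : ∀ n {f g : List ℕ → ℕ} → (∀ ls → f ls ≡ g ls) → sumComp n f ≡ sumComp n g
sumComp-cong zero h = h []
sumComp-cong (suc n) {f} {g} h = cong₂ _+_ (sumComp-cong n (λ ls → h (1 ∷ ls))) (sumComp-cong n bumped)
  where
  bumped : ∀ ls → bumpHead f ls ≡ bumpHead g ls
  bumped [] = refl
  bumped (l ∷ ls) = h (suc l ∷ ls)

sumComp-cong-∷ : ∀ n {f g : List ℕ → ℕ} → (∀ e ls → f (e ∷ ls) ≡ g (e ∷ ls)) → sumComp (suc n) f ≡ sumComp (suc n) g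
sumComp-cong-∷ n {f} {g} h = cong₂ _+_ (sumComp-cong n (h 1)) (sumComp-cong n bumped)
  where
  bumped : ∀ ls → bumpHead f ls ≡ bumpHead g ls
  bumped [] = refl
  bumped (l ∷ ls) = h (suc l) ls

sumComp-zero : ∀ n {f : List ℕ → ℕ} → (∀ ls → f ls ≡ 0) → sumComp n f ≡ 0
sumComp-zero n h = trans (sumComp-cong n h) (sumComp-const0 n)
  where
  sumComp-const0 : ∀ n → sumComp n (λ _ → 0) ≡ 0
  sumComp-const0 zero = refl
  sumComp-const0 (suc n) = cong₂ _+_ (sumComp-const0 n) (trans (sumComp-cong n (λ { [] → refl ; (_ ∷ _) → refl })) (sumComp-const0 n))

sumComp-zero-∷ : ∀ n {f : List ℕ → ℕ} → (∀ e ls → f (e ∷ ls) ≡ 0) → sumComp (suc n) f ≡ 0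
sumComp-zero-∷ n h = trans (sumComp-cong-∷ n h) (sumComp-zero (suc n) (λ _ → refl))

sumComp-*ˡ : ∀ n c (f : List ℕ → ℕ) → sumComp n (λ ls → c * f ls) ≡ c * sumComp n f
sumComp-*ˡ zero c f = refl
sumComp-*ˡ (suc n) c f =
  trans (cong₂ _+_ (sumComp-*ˡ n c (λ ls → f (1 ∷ ls))) (trans (sumComp-cong n bumped) (sumComp-*ˡ n c (bumpHead f))))
        (sym (NP.*-distribˡ-+ c _ _))
  where
  bumped : ∀ ls → bumpHead (λ ls → c * f ls) ls ≡ c * bumpHead f ls
  bumped [] = sym (NP.*-zeroʳ c)
  bumped (l ∷ ls) = refl

sumComp-*ʳ : ∀ n (f : List ℕ → ℕ) c → sumComp n (λ ls → f ls * c) ≡ sumComp n f * c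
sumComp-*ʳ n f c = trans (sumComp-cong n (λ ls → NP.*-comm (f ls) c)) (trans (sumComp-*ˡ n c f) (NP.*-comm c (sumComp n f)))

sumComp-+ : ∀ n (f g : List ℕ → ℕ) → sumComp n (λ ls → f ls + g ls) ≡ sumComp n f + sumComp n g
sumComp-+ zero f g = refl
sumComp-+ (suc n) f g =
  trans (cong₂ _+_ (sumComp-+ n (λ ls → f (1 ∷ ls)) (λ ls → g (1 ∷ ls)))
                   (trans (sumComp-cong n bumped) (sumComp-+ n (bumpHead f) (bumpHead g))))
        ([m+n]+[o+p]≡[m+o]+[n+p] (sumComp n (λ ls → f (1 ∷ ls))) _ _ _)
  where
  bumped : ∀ ls → bumpHead (λ ls → f ls + g ls) ls ≡ bumpHead f ls + bumpHead g ls
  bumped [] = refl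
  bumped (l ∷ ls) = refl

sumComp-length≡1 : ∀ n c → sumComp (suc n) (λ ls → toℕ (length ls ≡ᵇ 1) * c) ≡ c
sumComp-length≡1 n c = trans (sumComp-*ʳ (suc n) _ c) (trans (cong (_* c) (count-one n)) (NP.*-identityˡ c))
  where
  count-one : ∀ n → sumComp (suc n) (λ ls → toℕ (length ls ≡ᵇ 1)) ≡ 1
  count-one zero = refl
  count-one (suc n) =
    cong₂ _+_ (sumComp-zero-∷ n (λ _ _ → refl)) (trans (sumComp-cong (suc n) (λ { [] → refl ; (_ ∷ _) → refl })) (count-one n))

tailMatches : List ℤ → List ℕ → ℕ
tailMatches (i ∷ u) (k ∷ α) = eqℤs u (map toℤ α)
tailMatches _ _ = 0

-- weight u v α bs unfolds the recurrence of shuffleCountℤ along the block pattern bs: an A-block of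
-- length l takes the y from u in l consecutive steps, a B-block from v; once the word the next block
-- draws from is empty, the rest is forced and only its tail is compared with α.
mutual
  weight : List ℤ → List ℤ → List ℕ → List (Tag × ℕ) → ℕ
  weight u v α [] = 1
  weight u v α ((t , l) ∷ bs) = weightBlock t l u v α bs

  weightBlock : Tag → ℕ → List ℤ → List ℤ → List ℕ → List (Tag × ℕ) → ℕ
  weightBlock A l u [] α bs = tailMatches u α
  weightBlock A l u (j ∷ v) α bs = weightA l u (j ∷ v) α bs
  weightBlock B n [] v α bs = tailMatches v α
  weightBlock B n (i ∷ u) v α bs = weightB n (i ∷ u) v α bs

  weightA : ℕ → List ℤ → List ℤ → List ℕ → List (Tag × ℕ) → ℕ
  weightA zero u v α bs = weight u v α bs
  weightA (suc l) (i ∷ u) (j ∷ v) (k ∷ α) bs = binom k i * weightA l u (rest i j k ∷ v) α bs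
  weightA (suc l) [] v α bs = 0
  weightA (suc l) (i ∷ u) [] α bs = 0
  weightA (suc l) (i ∷ u) (j ∷ v) [] bs = 0

  weightB : ℕ → List ℤ → List ℤ → List ℕ → List (Tag × ℕ) → ℕ
  weightB zero u v α bs = weight u v α bs
  weightB (suc n) (i ∷ u) (j ∷ v) (k ∷ α) bs = binom k j * weightB n (rest i j k ∷ u) v α bs
  weightB (suc n) [] v α bs = 0
  weightB (suc n) (i ∷ u) [] α bs = 0
  weightB (suc n) (i ∷ u) (j ∷ v) [] bs = 0

admissibleA : List ℕ → List ℕ → ℕ
admissibleA ls ns = toℕ (length ls ≡ᵇ suc (length ns)) + toℕ (length ns ≡ᵇ length ls)

admissibleB : List ℕ → List ℕ → ℕ
admissibleB ls ns = toℕ (length ns ≡ᵇ suc (length ls)) + toℕ (length ls ≡ᵇ length ns)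

expansionA : List ℤ → List ℤ → List ℕ → ℕ
expansionA u v α =
  sumComp (length u) (λ ls → sumComp (length v) (λ ns → admissibleA ls ns * weight u v α (alt A ls ns)))

expansionB : List ℤ → List ℤ → List ℕ → ℕ
expansionB u v α =
  sumComp (length u) (λ ls → sumComp (length v) (λ ns → admissibleB ls ns * weight u v α (alt B ls ns)))

-- Splitting off the first step: an A-pattern whose first block has length 1 continues as a B-pattern, otherwise as a shorter A-pattern.
expansionA-∷ : ∀ i u j v k α →
  expansionA (i ∷ u) (j ∷ v) (k ∷ α) ≡ binom k i * (expansionB u (rest i j k ∷ v) α + expansionA u (rest i j k ∷ v) α)
expansionA-∷ i u j v k α = trans (cong₂ _+_ first-block-1 first-block-more) (sym (NP.*-distribˡ-+ (binom k i) _ _))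
  where
  h = rest i j k
  F : List ℕ → ℕ
  F ls = sumComp (suc (length v)) (λ ns → admissibleA ls ns * weight (i ∷ u) (j ∷ v) (k ∷ α) (alt A ls ns))
  G : List ℕ → ℕ
  G ls = sumComp (suc (length v)) (λ ns → admissibleA ls ns * weight u (h ∷ v) α (alt A ls ns))
  first-block-1 : sumComp (length u) (λ ls → F (1 ∷ ls)) ≡ binom k i * expansionB u (h ∷ v) α
  first-block-1 =
    trans (sumComp-cong (length u) (λ ls →
            trans (sumComp-cong (suc (length v)) (λ ns →
                    trans (cong (_* (binom k i * weight u (h ∷ v) α (alt B ls ns))) (NP.+-comm (toℕ (length ls ≡ᵇ length ns)) _))
                          (m*[n*o]≡n*[m*o] (admissibleB ls ns) (binom k i) (weight u (h ∷ v) α (alt B ls ns)))))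
                  (sumComp-*ˡ (suc (length v)) (binom k i) _)))
          (sumComp-*ˡ (length u) (binom k i) _)
  bumped : ∀ ls → bumpHead F ls ≡ binom k i * G ls
  bumped [] = sym (trans (cong (binom k i *_) (sumComp-zero-∷ (length v) (λ e ns → refl))) (NP.*-zeroʳ (binom k i)))
  bumped (l ∷ ls) =
    trans (sumComp-cong (suc (length v)) (λ ns → m*[n*o]≡n*[m*o] (admissibleA (l ∷ ls) ns) (binom k i) _))
          (sumComp-*ˡ (suc (length v)) (binom k i) _)
  first-block-more : sumComp (length u) (bumpHead F) ≡ binom k i * expansionA u (h ∷ v) α
  first-block-more = trans (sumComp-cong (length u) bumped) (sumComp-*ˡ (length u) (binom k i) G)

expansionB-∷ : ∀ i u j v k α →
  expansionB (i ∷ u) (j ∷ v) (k ∷ α) ≡ binom k j * (expansionA (rest i j k ∷ u) v α + expansionB (rest i j k ∷ u) v α)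
expansionB-∷ i u j v k α =
  trans (sumComp-cong-∷ (length u) split)
        (trans (sumComp-*ˡ (suc (length u)) (binom k j) (λ ls → IA ls + IB ls)) (cong (binom k j *_) (sumComp-+ (suc (length u)) IA IB)))
  where
  h = rest i j k
  IA : List ℕ → ℕ
  IA ls = sumComp (length v) (λ ns → admissibleA ls ns * weight (h ∷ u) v α (alt A ls ns))
  IB : List ℕ → ℕ
  IB ls = sumComp (length v) (λ ns → admissibleB ls ns * weight (h ∷ u) v α (alt B ls ns))
  split : ∀ e ls →
    sumComp (suc (length v)) (λ ns → admissibleB (e ∷ ls) ns * weight (i ∷ u) (j ∷ v) (k ∷ α) (alt B (e ∷ ls) ns))
                   ≡ binom k j * (IA (e ∷ ls) + IB (e ∷ ls))
  split e ls = trans (cong₂ _+_ first-block-1 first-block-more) (sym (NP.*-distribˡ-+ (binom k j) _ _))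
    where
    L = e ∷ ls
    first-block-1 : sumComp (length v) (λ ns → admissibleB L (1 ∷ ns) * weight (i ∷ u) (j ∷ v) (k ∷ α) ((B , 1) ∷ alt A L ns))
                    ≡ binom k j * IA L
    first-block-1 =
      trans (sumComp-cong (length v) (λ ns →
              trans (cong (_* (binom k j * weight (h ∷ u) v α (alt A L ns))) (NP.+-comm (toℕ (length ns ≡ᵇ length L)) _))
                    (m*[n*o]≡n*[m*o] (admissibleA L ns) (binom k j) (weight (h ∷ u) v α (alt A L ns)))))
            (sumComp-*ˡ (length v) (binom k j) _)
    bumped : ∀ ns → bumpHead (λ ns → admissibleB L ns * weight (i ∷ u) (j ∷ v) (k ∷ α) (alt B L ns)) ns
                    ≡ binom k j * (admissibleB L ns * weight (h ∷ u) v α (alt B L ns))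
    bumped [] = sym (NP.*-zeroʳ (binom k j))
    bumped (n ∷ ns) = m*[n*o]≡n*[m*o] (admissibleB L (n ∷ ns)) (binom k j) _
    first-block-more : sumComp (length v) (bumpHead (λ ns → admissibleB L ns * weight (i ∷ u) (j ∷ v) (k ∷ α) (alt B L ns)))
                       ≡ binom k j * IB L
    first-block-more = trans (sumComp-cong (length v) bumped) (sumComp-*ˡ (length v) (binom k j) _)

expansionA-[]ˡ : ∀ h v α → expansionA [] (h ∷ v) α ≡ 0
expansionA-[]ˡ h v α = sumComp-zero-∷ (length v) (λ e ns → refl)

expansionB-[]ʳ : ∀ h u α → expansionB (h ∷ u) [] α ≡ 0
expansionB-[]ʳ h u α = sumComp-zero-∷ (length u) (λ e ls → refl)

expansionB-[]ˡ : ∀ h v α → expansionB [] (h ∷ v) α ≡ tailMatches (h ∷ v) α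
expansionB-[]ˡ h v α =
  trans (sumComp-cong-∷ (length v) (λ e ns → cong (_* tailMatches (h ∷ v) α) (NP.+-identityʳ (toℕ (length ns ≡ᵇ 0)))))
        (sumComp-length≡1 (length v) (tailMatches (h ∷ v) α))

expansionA-[]ʳ : ∀ h u α → expansionA (h ∷ u) [] α ≡ tailMatches (h ∷ u) α
expansionA-[]ʳ h u α =
  trans (sumComp-cong-∷ (length u) (λ e ls → cong (_* tailMatches (h ∷ u) α) (NP.+-identityʳ (toℕ (length ls ≡ᵇ 0)))))
        (sumComp-length≡1 (length u) (tailMatches (h ∷ u) α))

sumℤ : List ℤ → ℤ
sumℤ = foldr ℤ._+_ (ℤ.+ 0)

-- The head of the remaining word is forced by the exponent sums.
eqℤs≡tailMatches : ∀ h v α → length α ≡ suc (length v) → sumℤ (map toℤ α) ≡ sumℤ (h ∷ v) →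
  eqℤs (h ∷ v) (map toℤ α) ≡ tailMatches (h ∷ v) α
eqℤs≡tailMatches h v (k ∷ α) _ Σ≡ =
  cong toℕ (does-⇔ (mk⇔ (λ e → proj₂ (LP.∷-injective e)) (λ e → cong₂ _∷_ (head-forced e) e))
                   (LP.≡-dec ℤ._≟_ (h ∷ v) (map toℤ (k ∷ α))) (LP.≡-dec ℤ._≟_ v (map toℤ α)))
  where
  head-forced : v ≡ map toℤ α → h ≡ ℤ.+ k
  head-forced refl = ℤ-+-cancelʳ (sumℤ v) h (ℤ.+ k) (sym Σ≡)

shuffleCountℤ-[]ˡ : ∀ h v α → length α ≡ suc (length v) → sumℤ (map toℤ α) ≡ sumℤ (h ∷ v) →
  shuffleCountℤ [] (h ∷ v) α ≡ expansionB [] (h ∷ v) α + expansionA [] (h ∷ v) α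
shuffleCountℤ-[]ˡ h v α l≡ Σ≡ rewrite expansionA-[]ˡ h v α | expansionB-[]ˡ h v α =
  trans (eqℤs≡tailMatches h v α l≡ Σ≡) (sym (NP.+-identityʳ _))

shuffleCountℤ-[]ʳ : ∀ h u α → length α ≡ suc (length u) → sumℤ (map toℤ α) ≡ sumℤ (h ∷ u) →
  shuffleCountℤ (h ∷ u) [] α ≡ expansionA (h ∷ u) [] α + expansionB (h ∷ u) [] α
shuffleCountℤ-[]ʳ h u α l≡ Σ≡ rewrite expansionB-[]ʳ h u α | expansionA-[]ʳ h u α =
  trans (eqℤs≡tailMatches h u α l≡ Σ≡) (sym (NP.+-identityʳ _))

sum-restˡ : ∀ k S i U j V → ℤ.+ k ℤ.+ S ≡ (i ℤ.+ U) ℤ.+ (j ℤ.+ V) → S ≡ U ℤ.+ (rest i j k ℤ.+ V)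
sum-restˡ k S i U j V e = begin
  S                                           ≡⟨ solve 2 (λ S K → S := (K :+ S) :- K) refl S (ℤ.+ k) ⟩
  (ℤ.+ k ℤ.+ S) ℤ.- ℤ.+ k                     ≡⟨ cong (ℤ._- ℤ.+ k) e ⟩
  ((i ℤ.+ U) ℤ.+ (j ℤ.+ V)) ℤ.- ℤ.+ k         ≡⟨ solve 5 (λ i U j V K → ((i :+ U) :+ (j :+ V)) :- K := U :+ (((i :+ j) :- K) :+ V))
                                                       refl i U j V (ℤ.+ k) ⟩
  U ℤ.+ (rest i j k ℤ.+ V)                    ∎
  where
  open ≡-Reasoning
  open ZS.+-*-Solver using (solve; _:+_; _:-_; _:=_)

sum-restʳ : ∀ k S i U j V → ℤ.+ k ℤ.+ S ≡ (i ℤ.+ U) ℤ.+ (j ℤ.+ V) → S ≡ (rest i j k ℤ.+ U) ℤ.+ V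
sum-restʳ k S i U j V e =
  trans (sum-restˡ k S i U j V e)
        (solve 3 (λ U R V → U :+ (R :+ V) := (R :+ U) :+ V) refl U (rest i j k) V)
  where open ZS.+-*-Solver using (solve; _:+_; _:=_)

shuffleCountℤ≡expansion : ∀ α i u j v → length α ≡ suc (length u) + suc (length v) →
  sumℤ (map toℤ α) ≡ sumℤ (i ∷ u) ℤ.+ sumℤ (j ∷ v) →
  shuffleCountℤ (i ∷ u) (j ∷ v) α ≡ expansionA (i ∷ u) (j ∷ v) α + expansionB (i ∷ u) (j ∷ v) α
shuffleCountℤ≡expansion (k ∷ α) i u j v l≡ Σ≡ =
  trans (cong₂ _+_ (cong (binom k i *_) (step-from-u u l≡ Σ≡)) (cong (binom k j *_) (step-from-v v l≡ Σ≡)))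
        (sym (cong₂ _+_ (expansionA-∷ i u j v k α) (expansionB-∷ i u j v k α)))
  where
  h = rest i j k
  S = sumℤ (map toℤ α)
  step-from-u : ∀ u → suc (length α) ≡ suc (length u) + suc (length v) → ℤ.+ k ℤ.+ S ≡ sumℤ (i ∷ u) ℤ.+ sumℤ (j ∷ v) →
                shuffleCountℤ u (h ∷ v) α ≡ expansionB u (h ∷ v) α + expansionA u (h ∷ v) α
  step-from-u [] l≡ Σ≡ =
    shuffleCountℤ-[]ˡ h v α (NP.suc-injective l≡) (trans (sum-restˡ k S i (ℤ.+ 0) j (sumℤ v) Σ≡) (ZP.+-identityˡ _))
  step-from-u (i′ ∷ u′) l≡ Σ≡ =
    trans (shuffleCountℤ≡expansion α i′ u′ h v (NP.suc-injective l≡) (sum-restˡ k S i (sumℤ (i′ ∷ u′)) j (sumℤ v) Σ≡))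
          (NP.+-comm (expansionA (i′ ∷ u′) (h ∷ v) α) _)
  step-from-v : ∀ v → suc (length α) ≡ suc (length u) + suc (length v) → ℤ.+ k ℤ.+ S ≡ sumℤ (i ∷ u) ℤ.+ sumℤ (j ∷ v) →
                shuffleCountℤ (h ∷ u) v α ≡ expansionA (h ∷ u) v α + expansionB (h ∷ u) v α
  step-from-v [] l≡ Σ≡ =
    shuffleCountℤ-[]ʳ h u α (trans (NP.suc-injective l≡) (NP.+-comm (length u) 1))
                           (trans (sum-restʳ k S i (sumℤ u) j (ℤ.+ 0) Σ≡) (ZP.+-identityʳ _))
  step-from-v (j′ ∷ v′) l≡ Σ≡ =
    shuffleCountℤ≡expansion α h u j′ v′ (trans (NP.suc-injective l≡) (NP.+-suc (length u) (suc (length v′))))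
                                        (sum-restʳ k S i (sumℤ u) j (sumℤ (j′ ∷ v′)) Σ≡)


sumBelow-suc-first : ∀ K (h : ℕ → ℕ) → sumBelow (suc K) h ≡ h 0 + sumBelow K (λ k → h (suc k))
sumBelow-suc-first zero h = NP.+-comm 0 (h 0)
sumBelow-suc-first (suc K) h rewrite sumBelow-suc-first K h = NP.+-assoc (h 0) (sumBelow K (λ k → h (suc k))) (h (suc K))

sumBelow-+ : ∀ N (g h : ℕ → ℕ) → sumBelow N (λ e → g e + h e) ≡ sumBelow N g + sumBelow N h
sumBelow-+ zero g h = refl
sumBelow-+ (suc N) g h rewrite sumBelow-+ N g h = [m+n]+[o+p]≡[m+o]+[n+p] (sumBelow N g) (sumBelow N h) (g N) (h N)

sumBelow-swap : ∀ K N (h : ℕ → ℕ → ℕ) → sumBelow K (λ k → sumBelow N (h k)) ≡ sumBelow N (λ e → sumBelow K (λ k → h k e))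
sumBelow-swap zero N h = sym (sumBelow-zero N (λ i _ → refl))
sumBelow-swap (suc K) N h rewrite sumBelow-swap K N h = sym (sumBelow-+ N (λ e → sumBelow K (λ k → h k e)) (h K))

sumBelow-*ˡ : ∀ N c (g : ℕ → ℕ) → sumBelow N (λ e → c * g e) ≡ c * sumBelow N g
sumBelow-*ˡ zero c g = sym (NP.*-zeroʳ c)
sumBelow-*ˡ (suc N) c g rewrite sumBelow-*ˡ N c g = sym (NP.*-distribˡ-+ c (sumBelow N g) (g N))

sumCompByFirst : ℕ → ℕ → (List ℕ → ℕ) → ℕ
sumCompByFirst N m f =
  eqℕ 0 m * f [] + sumBelow N (λ e → ind≤ (suc e) m * sumComp (m ∸ suc e) (λ ls → f (suc e ∷ ls)))

sumComp≡sumCompByFirst : ∀ m N f → m ≤ N → sumComp m f ≡ sumCompByFirst N m f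
sumComp≡sumCompByFirst zero N f _ =
  sym (trans (cong₂ _+_ (NP.+-identityʳ (f [])) (sumBelow-zero N (λ i _ → refl))) (NP.+-identityʳ (f [])))
sumComp≡sumCompByFirst (suc m) (suc N) f (s≤s m≤N) = begin
  first + sumComp m (bumpHead f)
    ≡⟨ cong (first +_) (sumComp≡sumCompByFirst m (suc N) (bumpHead f) (NP.m≤n⇒m≤1+n m≤N)) ⟩
  first + (eqℕ 0 m * 0 + (sumBelow N later + ind≤ (suc N) m * sumComp (m ∸ suc N) (λ ls → f (suc (suc N) ∷ ls))))
    ≡⟨ cong (λ z → first + (z + (sumBelow N later + toℕ (leq (suc N) m) * sumComp (m ∸ suc N) (λ ls → f (suc (suc N) ∷ ls)))))
            (NP.*-zeroʳ (eqℕ 0 m)) ⟩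
  first + (sumBelow N later + toℕ (leq (suc N) m) * sumComp (m ∸ suc N) (λ ls → f (suc (suc N) ∷ ls)))
    ≡⟨ cong (λ b → first + (sumBelow N later + toℕ b * sumComp (m ∸ suc N) (λ ls → f (suc (suc N) ∷ ls))))
            (leq-false (suc N) m (s≤s m≤N)) ⟩
  first + (sumBelow N later + 0)
    ≡⟨ cong₂ _+_ (sym (NP.+-identityʳ first)) (NP.+-identityʳ _) ⟩
  ind≤ 0 m * sumComp (m ∸ 0) (λ ls → f (1 ∷ ls)) + sumBelow N later
    ≡⟨ sym (sumBelow-suc-first N (λ e → ind≤ e m * sumComp (m ∸ e) (λ ls → f (suc e ∷ ls)))) ⟩
  sumCompByFirst (suc N) (suc m) f ∎
  where
  open ≡-Reasoning
  first = sumComp m (λ ls → f (1 ∷ ls))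
  later : ℕ → ℕ
  later e = ind≤ (suc e) m * sumComp (m ∸ suc e) (λ ls → f (suc (suc e) ∷ ls))

positivesUpTo : ℕ → List ℕ
positivesUpTo N = map suc (upTo N)

sumOverLists : ℕ → ℕ → ℕ → (List ℕ → ℕ) → ℕ
sumOverLists N k m f = sumOver (λ c → eqℕ (sum c) m * f c) (allLists k (positivesUpTo N))

eqℕ-+ : ∀ e s m → eqℕ (e + s) m ≡ ind≤ e m * eqℕ s (m ∸ e)
eqℕ-+ e s m with leq e m in eq
... | true =
  trans (cong toℕ (does-⇔ (mk⇔ (λ q → trans (sym (NP.m+n∸m≡n e s)) (cong (_∸ e) q))
                               (λ q → trans (cong (e +_) q) (NP.m+[n∸m]≡n (leq-sound e m eq))))
                          ((e + s) ℕ.≟ m) (s ℕ.≟ (m ∸ e))))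
        (sym (NP.+-identityʳ _))
... | false = χ-no ((e + s) ℕ.≟ m) (λ q → case trans (sym (leq-complete e m (subst (e ≤_) q (NP.m≤m+n e s)))) eq of λ ())

sumOverLists-suc : ∀ N k m f →
  sumOverLists N (suc k) m f ≡ sumBelow N (λ e → ind≤ (suc e) m * sumOverLists N k (m ∸ suc e) (λ c → f (suc e ∷ c)))
sumOverLists-suc N k m f = begin
  sumOverLists N (suc k) m f
    ≡⟨ sumOver-allLists-suc k (positivesUpTo N) (λ c → eqℕ (sum c) m * f c) ⟩
  sumOver (λ e → sumOver (λ c → eqℕ (e + sum c) m * f (e ∷ c)) (allLists k (positivesUpTo N))) (positivesUpTo N)
    ≡⟨ sumOver-cong (positivesUpTo N) split-first ⟩
  sumOver (λ e → ind≤ e m * sumOverLists N k (m ∸ e) (λ c → f (e ∷ c))) (positivesUpTo N)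
    ≡⟨ sumOver-map _ suc (upTo N) ⟩
  sumOver (λ e → ind≤ (suc e) m * sumOverLists N k (m ∸ suc e) (λ c → f (suc e ∷ c))) (upTo N)
    ≡⟨ sumOver-upTo _ N ⟩
  sumBelow N (λ e → ind≤ (suc e) m * sumOverLists N k (m ∸ suc e) (λ c → f (suc e ∷ c))) ∎
  where
  open ≡-Reasoning
  split-first : ∀ e → sumOver (λ c → eqℕ (e + sum c) m * f (e ∷ c)) (allLists k (positivesUpTo N))
                    ≡ ind≤ e m * sumOverLists N k (m ∸ e) (λ c → f (e ∷ c))
  split-first e =
    trans (sumOver-cong (allLists k (positivesUpTo N))
                        (λ c → trans (cong (_* f (e ∷ c)) (eqℕ-+ e (sum c) m)) (NP.*-assoc (ind≤ e m) _ (f (e ∷ c)))))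
          (sumOver-*ˡ (ind≤ e m) _ (allLists k (positivesUpTo N)))

-- Strong induction on m, with fuel b ≥ m.
sumOverLists≡sumComp : ∀ b m K N f → m ≤ b → m ≤ K → m ≤ N → sumBelow (suc K) (λ k → sumOverLists N k m f) ≡ sumComp m f
sumOverLists≡sumComp b m K N f m≤b m≤K m≤N = begin
  sumBelow (suc K) (λ k → sumOverLists N k m f)
    ≡⟨ sumBelow-suc-first K (λ k → sumOverLists N k m f) ⟩
  sumOverLists N 0 m f + sumBelow K (λ k → sumOverLists N (suc k) m f)
    ≡⟨ cong₂ _+_ (NP.+-identityʳ _) (sumBelow-cong K (λ k _ → sumOverLists-suc N k m f)) ⟩
  eqℕ 0 m * f [] + sumBelow K (λ k → sumBelow N (λ e → ind≤ (suc e) m * sumOverLists N k (m ∸ suc e) (λ c → f (suc e ∷ c))))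
    ≡⟨ cong (eqℕ 0 m * f [] +_) (sumBelow-swap K N _) ⟩
  eqℕ 0 m * f [] + sumBelow N (λ e → sumBelow K (λ k → ind≤ (suc e) m * sumOverLists N k (m ∸ suc e) (λ c → f (suc e ∷ c))))
    ≡⟨ cong (eqℕ 0 m * f [] +_) (sumBelow-cong N (λ e _ → trans (sumBelow-*ˡ K (ind≤ (suc e) m) _) (by-first e))) ⟩
  sumCompByFirst N m f
    ≡⟨ sym (sumComp≡sumCompByFirst m N f m≤N) ⟩
  sumComp m f ∎
  where
  open ≡-Reasoning
  by-first : ∀ e → ind≤ (suc e) m * sumBelow K (λ k → sumOverLists N k (m ∸ suc e) (λ c → f (suc e ∷ c)))
                 ≡ ind≤ (suc e) m * sumComp (m ∸ suc e) (λ ls → f (suc e ∷ ls))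
  by-first e = ind≤-*-cong (suc e) m (λ e<m → recurse b K e<m m≤b m≤K)
    where
    recurse : ∀ b K → suc e ≤ m → m ≤ b → m ≤ K →
      sumBelow K (λ k → sumOverLists N k (m ∸ suc e) (λ c → f (suc e ∷ c))) ≡ sumComp (m ∸ suc e) (λ ls → f (suc e ∷ ls))
    recurse b zero e<m _ m≤0 = ⊥-elim (NP.<-irrefl refl (NP.≤-trans e<m (NP.≤-trans m≤0 z≤n)))
    recurse zero (suc K) e<m m≤0 _ = ⊥-elim (NP.<-irrefl refl (NP.≤-trans e<m (NP.≤-trans m≤0 z≤n)))
    recurse (suc b) (suc K) _ m≤1+b m≤1+K =
      sumOverLists≡sumComp b (m ∸ suc e) K N (λ c → f (suc e ∷ c))
        (NP.≤-trans (NP.∸-monoˡ-≤ (suc e) m≤1+b) (NP.m∸n≤m b e)) (NP.≤-trans (NP.∸-monoˡ-≤ (suc e) m≤1+K) (NP.m∸n≤m K e))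
        (NP.≤-trans (NP.m∸n≤m m (suc e)) m≤N)

sumOver-compositions : ∀ n (f : List ℕ → ℕ) → sumOver f (compositions n) ≡ sumComp n f
sumOver-compositions n f = begin
  sumOver f (compositions n)
    ≡⟨ sumOver-filter (λ c → sum c ℕ.≟ n) f (concatMap (λ k → allLists k (positivesUpTo n)) (upTo (suc n))) ⟩
  sumOver (λ c → eqℕ (sum c) n * f c) (concatMap (λ k → allLists k (positivesUpTo n)) (upTo (suc n)))
    ≡⟨ sumOver-concatMap _ (λ k → allLists k (positivesUpTo n)) (upTo (suc n)) ⟩
  sumOver (λ k → sumOverLists n k n f) (upTo (suc n))
    ≡⟨ sumOver-upTo _ (suc n) ⟩
  sumBelow (suc n) (λ k → sumOverLists n k n f)
    ≡⟨ sumOverLists≡sumComp n n n n f NP.≤-refl NP.≤-refl NP.≤-refl ⟩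
  sumComp n f ∎
  where open ≡-Reasoning


-- Block patterns and the products of the paper

at₀ : List ℕ → ℕ → ℕ
at₀ [] i = 0
at₀ (v ∷ vs) zero = v
at₀ (v ∷ vs) (suc i) = at₀ vs i

at-suc : ∀ xs i → at xs (suc i) ≡ at₀ xs i
at-suc [] i = refl
at-suc (v ∷ vs) zero = refl
at-suc (v ∷ vs) (suc i) = at-suc vs i

atℤ₀ : List ℤ → ℕ → ℤ
atℤ₀ [] i = ℤ.+ 0
atℤ₀ (v ∷ vs) zero = v
atℤ₀ (v ∷ vs) (suc i) = atℤ₀ vs i

atℤ-suc : ∀ xs i → atℤ xs (suc i) ≡ atℤ₀ xs i
atℤ-suc [] i = refl
atℤ-suc (v ∷ vs) zero = refl
atℤ-suc (v ∷ vs) (suc i) = atℤ-suc vs i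

at₀-drop : ∀ m xs i → at₀ xs (m + i) ≡ at₀ (drop m xs) i
at₀-drop zero xs i = refl
at₀-drop (suc m) [] i = refl
at₀-drop (suc m) (q ∷ xs) i = at₀-drop m xs i

drop-at₀ : ∀ m xs → m < length xs → drop m xs ≡ at₀ xs m ∷ drop (suc m) xs
drop-at₀ zero (q ∷ xs) _ = refl
drop-at₀ (suc m) (q ∷ xs) (s≤s m<xs) = drop-at₀ m xs m<xs

sum-take-+ : ∀ m n xs → sum (take (m + n) xs) ≡ sum (take m xs) + sum (take n (drop m xs))
sum-take-+ zero n xs = refl
sum-take-+ (suc m) n [] = sym (cong sum (LP.take-[] n))
sum-take-+ (suc m) n (q ∷ xs) rewrite sum-take-+ m n xs = sym (NP.+-assoc q _ _)

sum-take-suc : ∀ m xs → sum (take (suc m) xs) ≡ sum (take m xs) + at₀ xs m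
sum-take-suc m xs rewrite sym (NP.+-comm m 1) | sum-take-+ m 1 xs = cong (sum (take m xs) +_) (sum-take-1-drop m xs)
  where
  sum-take-1-drop : ∀ m xs → sum (take 1 (drop m xs)) ≡ at₀ xs m
  sum-take-1-drop zero [] = refl
  sum-take-1-drop zero (q ∷ xs) = NP.+-identityʳ q
  sum-take-1-drop (suc m) [] = refl
  sum-take-1-drop (suc m) (q ∷ xs) = sum-take-1-drop m xs

sumℤ-map-+ : ∀ xs → sumℤ (map toℤ xs) ≡ ℤ.+ sum xs
sumℤ-map-+ [] = refl
sumℤ-map-+ (q ∷ xs) rewrite sumℤ-map-+ xs = refl

applyUpTo-cong : ∀ {A : Set} l {f g : ℕ → A} → (∀ i → f i ≡ g i) → applyUpTo f l ≡ applyUpTo g l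
applyUpTo-cong zero h = refl
applyUpTo-cong (suc l) h = cong₂ _∷_ (h 0) (applyUpTo-cong l (λ i → h (suc i)))

take-applyUpTo : ∀ l xs → l ≤ length xs → take l xs ≡ applyUpTo (at₀ xs) l
take-applyUpTo zero xs _ = refl
take-applyUpTo (suc l) (q ∷ xs) (s≤s l≤xs) = cong (q ∷_) (take-applyUpTo l xs l≤xs)

head₀ : List ℕ → ℕ
head₀ [] = 0
head₀ (v ∷ vs) = v

headℤ : List ℤ → ℤ
headℤ [] = ℤ.+ 0
headℤ (v ∷ vs) = v

tail₀ : ∀ {A : Set} → List A → List A
tail₀ [] = []
tail₀ (v ∷ vs) = vs

binomProd : ℕ → List ℕ → List ℤ → ℕ
binomProd zero α β = 1
binomProd (suc E) α β = binom (head₀ α) (headℤ β) * binomProd E (tail₀ α) (tail₀ β)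

deltaProd : ℕ → List ℕ → List ℕ → ℕ
deltaProd zero α β = 1
deltaProd (suc E) α β = δ (head₀ α) (head₀ β) * deltaProd E (tail₀ α) (tail₀ β)

binomProd-take : ∀ E α β → binomProd E α β ≡ binomProd E α (take E β)
binomProd-take zero α β = refl
binomProd-take (suc E) α [] = refl
binomProd-take (suc E) α (h ∷ β) = cong (binom (head₀ α) h *_) (binomProd-take E (tail₀ α) β)

rest-zero : ∀ j → j ≡ j ℤ.+ (ℤ.+ 0 ℤ.- ℤ.+ 0)
rest-zero j = solve 1 (λ j → j := j :+ (con (ℤ.+ 0) :- con (ℤ.+ 0))) refl j
  where open ZS.+-*-Solver using (solve; _:+_; _:-_; _:=_; con)

rest-carry : ∀ j i S k T → rest i j k ℤ.+ (S ℤ.- T) ≡ j ℤ.+ ((i ℤ.+ S) ℤ.- (ℤ.+ k ℤ.+ T))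
rest-carry j i S k T =
  solve 5 (λ i j S K T → ((i :+ j) :- K) :+ (S :- T) := j :+ ((i :+ S) :- (K :+ T))) refl i j S (ℤ.+ k) T
  where open ZS.+-*-Solver using (solve; _:+_; _:-_; _:=_)

weightA-run : ∀ l U j v α' bs → l ≤ length U → l ≤ length α' →
  weightA l U (j ∷ v) α' bs ≡ binomProd l α' U * weight (drop l U) ((j ℤ.+ (sumℤ (take l U) ℤ.- (ℤ.+ sum (take l α')))) ∷ v) (drop l α') bs
weightA-run zero U j v α' bs _ _ = trans (cong (λ z → weight U (z ∷ v) α' bs) (rest-zero j)) (sym (NP.+-identityʳ _))
weightA-run (suc l) (i ∷ U) j v (k ∷ α') bs (s≤s l≤U) (s≤s l≤α') rewrite weightA-run l U (rest i j k) v α' bs l≤U l≤α'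
  | rest-carry j i (sumℤ (take l U)) k (ℤ.+ sum (take l α')) = sym (NP.*-assoc (binom k i) (binomProd l α' U) _)

weightB-run : ∀ l i u V α' bs → l ≤ length V → l ≤ length α' →
  weightB l (i ∷ u) V α' bs ≡ binomProd l α' V * weight ((i ℤ.+ (sumℤ (take l V) ℤ.- (ℤ.+ sum (take l α')))) ∷ u) (drop l V) (drop l α') bs
weightB-run zero i u V α' bs _ _ = trans (cong (λ z → weight (z ∷ u) V α' bs) (rest-zero i)) (sym (NP.+-identityʳ _))
weightB-run (suc l) i u (j ∷ V) (k ∷ α') bs (s≤s l≤V) (s≤s l≤α') rewrite weightB-run l (rest i j k) u V α' bs l≤V l≤α'
  | trans (cong (ℤ._+ _) (rest-comm i j k)) (rest-carry i j (sumℤ (take l V)) k (ℤ.+ sum (take l α'))) =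
  sym (NP.*-assoc (binom k j) (binomProd l α' V) _)


data Alternating : Tag → Tag → List ℕ → List ℕ → Set where
  lastA : ∀ l → Alternating A A (suc l ∷ []) []
  lastB : ∀ n → Alternating B B [] (suc n ∷ [])
  consA : ∀ {e} l {ls ns} → Alternating B e ls ns → Alternating A e (suc l ∷ ls) ns
  consB : ∀ {e} n {ls ns} → Alternating A e ls ns → Alternating B e ls (suc n ∷ ns)

δ≡χ : ∀ p q → δ p q ≡ χ (toℤ q ℤ.≟ toℤ p)
δ≡χ p q =
  trans (if-toℕ (p ≡ᵇ q))
        (cong toℕ (does-⇔ (mk⇔ (λ e → cong toℤ (sym e)) (λ e → sym (ZP.+-injective e))) (p ℕ.≟ q) (toℤ q ℤ.≟ toℤ p)))
  where
  if-toℕ : ∀ b → (if b then 1 else 0) ≡ toℕ b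
  if-toℕ true = refl
  if-toℕ false = refl

deltaProd≡eqℤs : ∀ m xs ys → length xs ≡ m → length ys ≡ m → deltaProd m xs ys ≡ eqℤs (map toℤ ys) (map toℤ xs)
deltaProd≡eqℤs zero [] [] _ _ = refl
deltaProd≡eqℤs (suc m) (p ∷ xs) (q ∷ ys) l₁ l₂
  rewrite δ≡χ p q | deltaProd≡eqℤs m xs ys (NP.suc-injective l₁) (NP.suc-injective l₂) =
  sym (toℕ-∧ (does (toℤ q ℤ.≟ toℤ p)) (does (LP.≡-dec ℤ._≟_ (map toℤ ys) (map toℤ xs))))

-- The paper's summand for a block pattern: binomials over every block but the last, whose first
-- exponent is forced and whose other exponents must equal those of a or b (the Kronecker deltas).
module PaperProduct (a b α : List ℕ) where

  βA : ℕ → ℕ → ℤ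
  βA ca cb = (ℤ.+ (sumTo a (suc ca) + sumTo b cb)) ℤ.- (ℤ.+ sumTo α (ca + cb))

  βB : ℕ → ℕ → ℤ
  βB ca cb = (ℤ.+ (sumTo a ca + sumTo b (suc cb))) ℤ.- (ℤ.+ sumTo α (ca + cb))

  paperProduct : ℕ → ℕ → List (Tag × ℕ) → ℕ
  paperProduct ca cb [] = 1
  paperProduct ca cb ((A , l) ∷ []) = deltaProd (l ∸ 1) (drop (suc (ca + cb)) α) (drop (suc ca) a)
  paperProduct ca cb ((B , n) ∷ []) = deltaProd (n ∸ 1) (drop (suc (ca + cb)) α) (drop (suc cb) b)
  paperProduct ca cb ((A , l) ∷ blk ∷ bs) = binomProd l (drop (ca + cb) α) (blockSeq a b α ca cb ((A , l) ∷ blk ∷ bs)) *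
      paperProduct (ca + l) cb (blk ∷ bs)
  paperProduct ca cb ((B , n) ∷ blk ∷ bs) = binomProd n (drop (ca + cb) α) (blockSeq a b α ca cb ((B , n) ∷ blk ∷ bs)) *
      paperProduct ca (cb + n) (blk ∷ bs)

  paperProduct-consA : ∀ {e ls ns} → Alternating B e ls ns → ∀ ca cb l →
    paperProduct ca cb ((A , suc l) ∷ alt B ls ns)
    ≡ binomProd (suc l) (drop (ca + cb) α) (blockSeq a b α ca cb ((A , suc l) ∷ alt B ls ns)) * paperProduct (ca + suc l) cb (alt B ls ns)
  paperProduct-consA (lastB n) ca cb l = refl
  paperProduct-consA (consB n p) ca cb l = refl

  paperProduct-consB : ∀ {e ls ns} → Alternating A e ls ns → ∀ ca cb n →
    paperProduct ca cb ((B , suc n) ∷ alt A ls ns)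
    ≡ binomProd (suc n) (drop (ca + cb) α) (blockSeq a b α ca cb ((B , suc n) ∷ alt A ls ns)) * paperProduct ca (cb + suc n) (alt A ls ns)
  paperProduct-consB (lastA l) ca cb n = refl
  paperProduct-consB (consA l p) ca cb n = refl

take-++-length : ∀ {X : Set} (Q R : List X) l → length Q ≡ l → take l (Q ++ R) ≡ Q
take-++-length [] R zero e = refl
take-++-length (q ∷ Q) R (suc l) e = cong (q ∷_) (take-++-length Q R l (NP.suc-injective e))

block-entries : ∀ (w : List ℕ) c l → suc c + l ≤ length w →
  map (λ t → ℤ.+ at w (c + t)) (range 2 (suc l)) ≡ take l (map toℤ (drop (suc c) w))
block-entries w c l fits = begin
  map (λ t → ℤ.+ at w (c + t)) (map (λ i → 2 + i) (upTo l))
    ≡⟨ sym (LP.map-∘ (upTo l)) ⟩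
  map (λ i → ℤ.+ at w (c + (2 + i))) (upTo l)
    ≡⟨ LP.map-upTo _ l ⟩
  applyUpTo (λ i → ℤ.+ at w (c + (2 + i))) l
    ≡⟨ applyUpTo-cong l entry ⟩
  applyUpTo (λ i → ℤ.+ (at₀ (drop (suc c) w) i)) l
    ≡⟨ sym (LP.map-applyUpTo (at₀ (drop (suc c) w)) toℤ l) ⟩
  map toℤ (applyUpTo (at₀ (drop (suc c) w)) l)
    ≡⟨ cong (map toℤ) (sym (take-applyUpTo l (drop (suc c) w)
        (subst (l ≤_) (sym (LP.length-drop (suc c) w))
        (NP.m+n≤o⇒m≤o∸n l (subst (_≤ length w) (NP.+-comm (suc c) l) fits))))) ⟩
  map toℤ (take l (drop (suc c) w))
    ≡⟨ sym (LP.take-map l (drop (suc c) w)) ⟩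
  take l (map toℤ (drop (suc c) w)) ∎
  where
  open ≡-Reasoning
  entry : ∀ i → ℤ.+ at w (c + (2 + i)) ≡ ℤ.+ (at₀ (drop (suc c) w) i)
  entry i = cong toℤ (trans (cong (at w) (trans (NP.+-suc c (suc i)) (cong suc (NP.+-suc c i))))
      (trans (at-suc w (suc (c + i))) (at₀-drop (suc c) w i)))

length-block-entries : ∀ (w : List ℕ) c l → length (map (λ t → ℤ.+ at w (c + t)) (range 2 (suc l))) ≡ l
length-block-entries w c l = trans (LP.length-map _ (range 2 (suc l))) (trans (LP.length-map _ (upTo l)) (LP.length-upTo l))

weight-cong : ∀ {u u' v v' α1 α2} bs → u ≡ u' → v ≡ v' → α1 ≡ α2 → weight u v α1 bs ≡ weight u' v' α2 bs
weight-cong bs refl refl refl = refl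

βA-carry : ∀ A₁ B₀ S₀ X T J → ℤ.+ J ℤ.+ ((((ℤ.+ (A₁ + B₀)) ℤ.- ℤ.+ S₀) ℤ.+ ℤ.+ X) ℤ.- ℤ.+ T)
                              ≡ ℤ.+ ((A₁ + X) + (B₀ + J)) ℤ.- ℤ.+ (S₀ + T)
βA-carry A₁ B₀ S₀ X T J =
  solve 6 (λ A₁ B₀ S₀ X T J → J :+ ((((A₁ :+ B₀) :- S₀) :+ X) :- T) := ((A₁ :+ X) :+ (B₀ :+ J)) :- (S₀ :+ T))
    refl (ℤ.+ A₁) (ℤ.+ B₀) (ℤ.+ S₀) (ℤ.+ X) (ℤ.+ T) (ℤ.+ J)
  where open ZS.+-*-Solver using (solve; _:+_; _:-_; _:=_)

βB-carry : ∀ A₀ B₁ S₀ Y T I → ℤ.+ I ℤ.+ ((((ℤ.+ (A₀ + B₁)) ℤ.- ℤ.+ S₀) ℤ.+ ℤ.+ Y) ℤ.- ℤ.+ T)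
                              ≡ ℤ.+ ((A₀ + I) + (B₁ + Y)) ℤ.- ℤ.+ (S₀ + T)
βB-carry A₀ B₁ S₀ Y T I =
  solve 6 (λ A₀ B₁ S₀ Y T I → I :+ ((((A₀ :+ B₁) :- S₀) :+ Y) :- T) := ((A₀ :+ I) :+ (B₁ :+ Y)) :- (S₀ :+ T))
    refl (ℤ.+ A₀) (ℤ.+ B₁) (ℤ.+ S₀) (ℤ.+ Y) (ℤ.+ T) (ℤ.+ I)
  where open ZS.+-*-Solver using (solve; _:+_; _:-_; _:=_)

module WeightSteps (a b α : List ℕ) where
  open PaperProduct a b α

  blockA : ℕ → ℕ → List ℤ
  blockA ca l = map (λ t → ℤ.+ at a (ca + t)) (range 2 (suc l))
  blockB : ℕ → ℕ → List ℤ
  blockB cb n = map (λ t → ℤ.+ at b (cb + t)) (range 2 (suc n))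

  βB-after-blockA : ∀ ca cb l →
    ℤ.+ (at₀ b cb) ℤ.+ (sumℤ (take (suc l) (βA ca cb ∷ map toℤ (drop (suc ca) a))) ℤ.- ℤ.+ sum (take (suc l) (drop (ca + cb) α)))
    ≡ βB (ca + suc l) cb
  βB-after-blockA ca cb l = begin
    j ℤ.+ ((βA ca cb ℤ.+ sumℤ (take l (map toℤ D))) ℤ.- (ℤ.+ sum (take (suc l) α')))
      ≡⟨ cong (λ z → j ℤ.+ ((βA ca cb ℤ.+ z) ℤ.- (ℤ.+ sum (take (suc l) α'))))
          (trans (cong sumℤ (LP.take-map l D)) (sumℤ-map-+ (take l D))) ⟩
    j ℤ.+ ((βA ca cb ℤ.+ ℤ.+ sum (take l D)) ℤ.- (ℤ.+ sum (take (suc l) α')))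
      ≡⟨ βA-carry (sumTo a (suc ca)) (sumTo b cb) (sumTo α (ca + cb)) (sum (take l D)) (sum (take (suc l) α')) (at₀ b cb) ⟩
    (ℤ.+ ((sumTo a (suc ca) + sum (take l D)) + (sumTo b cb + at₀ b cb))) ℤ.- (ℤ.+ (sumTo α (ca + cb) + sum (take (suc l) α')))
      ≡⟨ cong₂ (λ p q → (ℤ.+ (p + q)) ℤ.- (ℤ.+ (sumTo α (ca + cb) + sum (take (suc l) α'))))
          (sym (trans (cong (λ z → sum (take z a)) (NP.+-suc ca l)) (sum-take-+ (suc ca) l a)))
          (sym (sum-take-suc cb b)) ⟩
    (ℤ.+ (sumTo a (ca + suc l) + sumTo b (suc cb))) ℤ.- (ℤ.+ (sumTo α (ca + cb) + sum (take (suc l) α')))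
      ≡⟨ cong (λ z → (ℤ.+ (sumTo a (ca + suc l) + sumTo b (suc cb))) ℤ.- (ℤ.+ z))
          (sym (trans (cong (λ z → sum (take z α)) (sym offset-comm)) (sum-take-+ (ca + cb) (suc l) α))) ⟩
    βB (ca + suc l) cb ∎
    where
    D = drop (suc ca) a
    j = ℤ.+ (at₀ b cb)
    α' = drop (ca + cb) α
    open ≡-Reasoning
    offset-comm : ca + cb + suc l ≡ ca + suc l + cb
    offset-comm = trans (NP.+-assoc ca cb (suc l)) (trans (cong (ca +_) (NP.+-comm cb (suc l))) (sym (NP.+-assoc ca (suc l) cb)))

  weight-stepA : ∀ ca cb l bs → cb < length b → suc ca + l ≤ length a → ca + cb + suc l ≤ length α →
    weight (βA ca cb ∷ map toℤ (drop (suc ca) a)) (map toℤ (drop cb b)) (drop (ca + cb) α) ((A , suc l) ∷ bs)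
    ≡ binomProd (suc l) (drop (ca + cb) α) (βA ca cb ∷ (blockA ca l ++ blockSeq a b α (ca + suc l) cb bs))
      * weight (map toℤ (drop (ca + suc l) a)) (βB (ca + suc l) cb ∷ map toℤ (drop (suc cb) b)) (drop (ca + suc l + cb) α) bs
  weight-stepA ca cb l bs i<len a-fits α-fits rewrite drop-at₀ cb b i<len =
    trans (weightA-run (suc l) U j v α' bs l≤U l≤α′) (cong₂ _*_ binomProd-block (weight-cong bs drop-U (cong (_∷ v) (βB-after-blockA ca cb l)) drop-α′))
    where
    D = drop (suc ca) a
    U = βA ca cb ∷ map toℤ D
    j = ℤ.+ (at₀ b cb)
    v = map toℤ (drop (suc cb) b)
    α' = drop (ca + cb) α
    R = blockSeq a b α (ca + suc l) cb bs
    l≤U : suc l ≤ length U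
    l≤U = s≤s (subst (l ≤_) (sym (trans (LP.length-map toℤ D) (LP.length-drop (suc ca) a)))
        (NP.m+n≤o⇒m≤o∸n l (subst (_≤ length a) (NP.+-comm (suc ca) l) a-fits)))
    l≤α′ : suc l ≤ length α'
    l≤α′ = subst (suc l ≤_) (sym (LP.length-drop (ca + cb) α))
        (NP.m+n≤o⇒m≤o∸n (suc l) (subst (_≤ length α) (NP.+-comm (ca + cb) (suc l)) α-fits))
    binomProd-block : binomProd (suc l) α' U ≡ binomProd (suc l) α' (βA ca cb ∷ (blockA ca l ++ R))
    binomProd-block = cong (binom (head₀ α') (βA ca cb) *_)
      (trans (binomProd-take l (tail₀ α') (map toℤ D)) (trans
          (cong (binomProd l (tail₀ α')) (trans (sym (block-entries a ca l a-fits))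
          (sym (take-++-length (blockA ca l) R l (length-block-entries a ca l)))))
        (sym (binomProd-take l (tail₀ α') (blockA ca l ++ R)))))
    drop-U : drop (suc l) U ≡ map toℤ (drop (ca + suc l) a)
    drop-U = trans (LP.drop-map l D) (cong (map toℤ) (trans (LP.drop-drop (suc ca) l a) (cong (λ z → drop z a) (sym (NP.+-suc ca l)))))
    drop-α′ : drop (suc l) α' ≡ drop (ca + suc l + cb) α
    drop-α′ = trans (LP.drop-drop (ca + cb) (suc l) α) (cong (λ z → drop z α)
        (trans (NP.+-assoc ca cb (suc l)) (trans (cong (ca +_) (NP.+-comm cb (suc l)))
        (sym (NP.+-assoc ca (suc l) cb)))))

  βA-after-blockB : ∀ ca cb n →
    ℤ.+ (at₀ a ca) ℤ.+ (sumℤ (take (suc n) (βB ca cb ∷ map toℤ (drop (suc cb) b))) ℤ.- ℤ.+ sum (take (suc n) (drop (ca + cb) α)))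
    ≡ βA ca (cb + suc n)
  βA-after-blockB ca cb n = begin
    i ℤ.+ ((βB ca cb ℤ.+ sumℤ (take n (map toℤ D))) ℤ.- (ℤ.+ sum (take (suc n) α')))
      ≡⟨ cong (λ z → i ℤ.+ ((βB ca cb ℤ.+ z) ℤ.- (ℤ.+ sum (take (suc n) α'))))
          (trans (cong sumℤ (LP.take-map n D)) (sumℤ-map-+ (take n D))) ⟩
    i ℤ.+ ((βB ca cb ℤ.+ ℤ.+ sum (take n D)) ℤ.- (ℤ.+ sum (take (suc n) α')))
      ≡⟨ βB-carry (sumTo a ca) (sumTo b (suc cb)) (sumTo α (ca + cb)) (sum (take n D)) (sum (take (suc n) α')) (at₀ a ca) ⟩
    (ℤ.+ ((sumTo a ca + at₀ a ca) + (sumTo b (suc cb) + sum (take n D)))) ℤ.- (ℤ.+ (sumTo α (ca + cb) + sum (take (suc n) α')))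
      ≡⟨ cong₂ (λ p q → (ℤ.+ (p + q)) ℤ.- (ℤ.+ (sumTo α (ca + cb) + sum (take (suc n) α'))))
          (sym (sum-take-suc ca a)) (sym (trans (cong (λ z → sum (take z b)) (NP.+-suc cb n))
          (sum-take-+ (suc cb) n b))) ⟩
    (ℤ.+ (sumTo a (suc ca) + sumTo b (cb + suc n))) ℤ.- (ℤ.+ (sumTo α (ca + cb) + sum (take (suc n) α')))
      ≡⟨ cong (λ z → (ℤ.+ (sumTo a (suc ca) + sumTo b (cb + suc n))) ℤ.- (ℤ.+ z))
          (sym (trans (cong (λ z → sum (take z α)) (sym offset-comm)) (sum-take-+ (ca + cb) (suc n) α))) ⟩
    βA ca (cb + suc n) ∎
    where
    D = drop (suc cb) b
    i = ℤ.+ (at₀ a ca)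
    offset-comm : ca + cb + suc n ≡ ca + (cb + suc n)
    offset-comm = NP.+-assoc ca cb (suc n)
    α' = drop (ca + cb) α
    open ≡-Reasoning

  weight-stepB : ∀ ca cb n bs → ca < length a → suc cb + n ≤ length b → ca + cb + suc n ≤ length α →
    weight (map toℤ (drop ca a)) (βB ca cb ∷ map toℤ (drop (suc cb) b)) (drop (ca + cb) α) ((B , suc n) ∷ bs)
    ≡ binomProd (suc n) (drop (ca + cb) α) (βB ca cb ∷ (blockB cb n ++ blockSeq a b α ca (cb + suc n) bs))
      * weight (βA ca (cb + suc n) ∷ map toℤ (drop (suc ca) a)) (map toℤ (drop (cb + suc n) b)) (drop (ca + (cb + suc n)) α) bs
  weight-stepB ca cb n bs i<len a-fits α-fits rewrite drop-at₀ ca a i<len =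
    trans (weightB-run (suc n) i u V α' bs l≤U l≤α′) (cong₂ _*_ binomProd-block (weight-cong bs (cong (_∷ u) (βA-after-blockB ca cb n)) drop-U drop-α′))
    where
    D = drop (suc cb) b
    V = βB ca cb ∷ map toℤ D
    i = ℤ.+ (at₀ a ca)
    u = map toℤ (drop (suc ca) a)
    α' = drop (ca + cb) α
    R = blockSeq a b α ca (cb + suc n) bs
    l≤U : suc n ≤ length V
    l≤U = s≤s (subst (n ≤_) (sym (trans (LP.length-map toℤ D) (LP.length-drop (suc cb) b)))
        (NP.m+n≤o⇒m≤o∸n n (subst (_≤ length b) (NP.+-comm (suc cb) n) a-fits)))
    l≤α′ : suc n ≤ length α'
    l≤α′ = subst (suc n ≤_) (sym (LP.length-drop (ca + cb) α))
        (NP.m+n≤o⇒m≤o∸n (suc n) (subst (_≤ length α) (NP.+-comm (ca + cb) (suc n)) α-fits))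
    binomProd-block : binomProd (suc n) α' V ≡ binomProd (suc n) α' (βB ca cb ∷ (blockB cb n ++ R))
    binomProd-block = cong (binom (head₀ α') (βB ca cb) *_)
      (trans (binomProd-take n (tail₀ α') (map toℤ D)) (trans
          (cong (binomProd n (tail₀ α')) (trans (sym (block-entries b cb n a-fits))
          (sym (take-++-length (blockB cb n) R n (length-block-entries b cb n)))))
        (sym (binomProd-take n (tail₀ α') (blockB cb n ++ R)))))
    drop-U : drop (suc n) V ≡ map toℤ (drop (cb + suc n) b)
    drop-U = trans (LP.drop-map n D) (cong (map toℤ) (trans (LP.drop-drop (suc cb) n b) (cong (λ z → drop z b) (sym (NP.+-suc cb n)))))
    offset-comm : ca + cb + suc n ≡ ca + (cb + suc n)
    offset-comm = NP.+-assoc ca cb (suc n)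
    drop-α′ : drop (suc n) α' ≡ drop (ca + (cb + suc n)) α
    drop-α′ = trans (LP.drop-drop (ca + cb) (suc n) α) (cong (λ z → drop z α) offset-comm)

  weight-lastA : ∀ ca cb l → length b ≤ cb → ca + cb < length α → length (drop (suc ca) a) ≡ l →
    length (drop (suc (ca + cb)) α) ≡ l →
    weight (βA ca cb ∷ map toℤ (drop (suc ca) a)) (map toℤ (drop cb b)) (drop (ca + cb) α) ((A , suc l) ∷ []) ≡
        paperProduct ca cb ((A , suc l) ∷ [])
  weight-lastA ca cb l b≤cb i<len rest-len α-rest-len rewrite LP.drop-all cb b b≤cb | drop-at₀ (ca + cb) α i<len =
    sym (deltaProd≡eqℤs l (drop (suc (ca + cb)) α) (drop (suc ca) a) α-rest-len rest-len)

  weight-lastB : ∀ ca cb n → length a ≤ ca → ca + cb < length α → length (drop (suc cb) b) ≡ n →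
    length (drop (suc (ca + cb)) α) ≡ n →
    weight (map toℤ (drop ca a)) (βB ca cb ∷ map toℤ (drop (suc cb) b)) (drop (ca + cb) α) ((B , suc n) ∷ []) ≡
        paperProduct ca cb ((B , suc n) ∷ [])
  weight-lastB ca cb n a≤ca i<len rest-len α-rest-len rewrite LP.drop-all ca a a≤ca | drop-at₀ (ca + cb) α i<len =
    sym (deltaProd≡eqℤs n (drop (suc (ca + cb)) α) (drop (suc cb) b) α-rest-len rest-len)

m+[1+l]+n∸[1+m+n]≡l : ∀ x0 y0 l → x0 + suc l + y0 ∸ suc (x0 + y0) ≡ l
m+[1+l]+n∸[1+m+n]≡l x0 y0 l = trans (cong (_∸ suc (x0 + y0)) eq) (NP.m+n∸m≡n (suc (x0 + y0)) l)
  where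
  eq : x0 + suc l + y0 ≡ suc (x0 + y0) + l
  eq = trans (cong (_+ y0) (NP.+-suc x0 l)) (cong suc (trans (NP.+-assoc x0 l y0)
      (trans (cong (x0 +_) (NP.+-comm l y0)) (sym (NP.+-assoc x0 y0 l)))))

m+[1+n]≡o⇒m<o : ∀ c m t → c + suc m ≡ t → c < t
m+[1+n]≡o⇒m<o c m t e = subst (c <_) e (subst (c <_) (sym (NP.+-suc c m)) (s≤s (NP.m≤m+n c m)))

m+[1+l+n]≡o⇒1+m+l≤o : ∀ c l m t → c + suc (l + m) ≡ t → suc c + l ≤ t
m+[1+l+n]≡o⇒1+m+l≤o c l m t e = subst (suc c + l ≤_) e (subst (suc c + l ≤_) (sym (NP.+-suc c (l + m)))
    (s≤s (subst (_≤ c + (l + m)) refl (NP.+-monoʳ-≤ c (NP.m≤m+n l m)))))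

blockA-fits : ∀ ca cb l m n r s → ca + suc (l + m) ≡ r → cb + n ≡ s → ca + cb + suc l ≤ r + s
blockA-fits ca cb l m n r s ≡r ≡s = subst (ca + cb + suc l ≤_) (cong₂ _+_ ≡r ≡s) (begin
  ca + cb + suc l ≡⟨ NP.+-assoc ca cb (suc l) ⟩
  ca + (cb + suc l) ≡⟨ cong (ca +_) (NP.+-comm cb (suc l)) ⟩
  ca + (suc l + cb) ≤⟨ NP.+-monoʳ-≤ ca (NP.+-monoˡ-≤ cb (s≤s (NP.m≤m+n l m))) ⟩
  ca + (suc (l + m) + cb) ≡⟨ sym (NP.+-assoc ca (suc (l + m)) cb) ⟩
  ca + suc (l + m) + cb ≤⟨ NP.+-monoʳ-≤ (ca + suc (l + m)) (NP.m≤m+n cb n) ⟩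
  ca + suc (l + m) + (cb + n) ∎)
  where open NP.≤-Reasoning

blockB-fits : ∀ ca cb l m n r s → ca + n ≡ r → cb + suc (l + m) ≡ s → ca + cb + suc l ≤ r + s
blockB-fits ca cb l m n r s ≡r ≡s = subst (ca + cb + suc l ≤_) (cong₂ _+_ ≡r ≡s)
  (subst (_≤ ca + n + (cb + suc (l + m))) (sym (NP.+-assoc ca cb (suc l)))
      (NP.+-mono-≤ (NP.m≤m+n ca n) (NP.+-monoʳ-≤ cb (s≤s (NP.m≤m+n l m)))))

length-drop-suc : ∀ (w : List ℕ) c l t → length w ≡ t → c + suc l ≡ t → length (drop (suc c) w) ≡ l
length-drop-suc w c l t lw e = trans (LP.length-drop (suc c) w)
    (trans (cong (_∸ suc c) (trans lw (sym e))) (trans (cong (_∸ suc c) (NP.+-suc c l)) (NP.m+n∸m≡n c l)))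

Alternating-sumᴬ : ∀ {e ls ns} → Alternating A e ls ns → 1 ≤ sum ls
Alternating-sumᴬ (lastA l) = s≤s z≤n
Alternating-sumᴬ (consA l p) = s≤s z≤n

Alternating-sumᴮ : ∀ {e ls ns} → Alternating B e ls ns → 1 ≤ sum ns
Alternating-sumᴮ (lastB n) = s≤s z≤n
Alternating-sumᴮ (consB n p) = s≤s z≤n

m+n≡o⇒m<o : ∀ m n o → m + n ≡ o → 1 ≤ n → m < o
m+n≡o⇒m<o m n o m+n≡o 1≤n = subst (m <_) m+n≡o (NP.m<m+n m 1≤n)

-- ca and cb count the letters of a and b used by the blocks before the current one.
module WeightIsPaperProduct (r s : ℕ) (a b α : List ℕ) (la : length a ≡ r) (lb : length b ≡ s) (lα : length α ≡ r + s) where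
  open PaperProduct a b α
  open WeightSteps a b α

  mutual
    weight≡paperProductA : ∀ {e ls ns} → Alternating A e ls ns → ∀ ca cb → ca + sum ls ≡ r → cb + sum ns ≡ s →
      weight (βA ca cb ∷ map toℤ (drop (suc ca) a)) (map toℤ (drop cb b)) (drop (ca + cb) α) (alt A ls ns)
      ≡ paperProduct ca cb (alt A ls ns)
    weight≡paperProductA (lastA l) ca cb ca+l+0≡r cb+0≡s = weight-lastA ca cb l b≤cb ca+cb<α a-rest α-rest
      where
      ca+l≡r : ca + suc l ≡ r
      ca+l≡r = trans (cong (ca +_) (sym (NP.+-identityʳ (suc l)))) ca+l+0≡r
      cb≡s : cb ≡ s
      cb≡s = trans (sym (NP.+-identityʳ cb)) cb+0≡s
      b≤cb : length b ≤ cb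
      b≤cb = NP.≤-reflexive (trans lb (sym cb≡s))
      α≡ : length α ≡ ca + suc l + cb
      α≡ = trans lα (sym (cong₂ _+_ ca+l≡r cb≡s))
      ca+cb<α : ca + cb < length α
      ca+cb<α = subst (ca + cb <_) (sym α≡) (NP.+-monoˡ-< cb (m+[1+n]≡o⇒m<o ca l (ca + suc l) refl))
      a-rest = length-drop-suc a ca l r la ca+l≡r
      α-rest : length (drop (suc (ca + cb)) α) ≡ l
      α-rest = trans (LP.length-drop (suc (ca + cb)) α) (trans (cong (_∸ suc (ca + cb)) α≡) (m+[1+l]+n∸[1+m+n]≡l ca cb l))
    weight≡paperProductA (consA l {ls = ls} {ns = ns} p) ca cb ≡r ≡s =
      trans (weight-stepA ca cb l (alt B ls ns)
               (subst (cb <_) (sym lb) (m+n≡o⇒m<o cb (sum ns) s ≡s (Alternating-sumᴮ p)))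
               (subst (suc ca + l ≤_) (sym la) (m+[1+l+n]≡o⇒1+m+l≤o ca l (sum ls) r ≡r))
               (subst (ca + cb + suc l ≤_) (sym lα) (blockA-fits ca cb l (sum ls) (sum ns) r s ≡r ≡s)))
            (trans (cong (binomProd (suc l) (drop (ca + cb) α)
                (βA ca cb ∷ (blockA ca l ++ blockSeq a b α (ca + suc l) cb (alt B ls ns))) *_)
                  (weight≡paperProductB p (ca + suc l) cb (trans (NP.+-assoc ca (suc l) (sum ls)) ≡r) ≡s))
                   (sym (paperProduct-consA p ca cb l)))

    weight≡paperProductB : ∀ {e ls ns} → Alternating B e ls ns → ∀ ca cb → ca + sum ls ≡ r → cb + sum ns ≡ s →
      weight (map toℤ (drop ca a)) (βB ca cb ∷ map toℤ (drop (suc cb) b)) (drop (ca + cb) α) (alt B ls ns)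
      ≡ paperProduct ca cb (alt B ls ns)
    weight≡paperProductB (lastB n) ca cb ca+0≡r cb+n+0≡s = weight-lastB ca cb n a≤ca ca+cb<α b-rest α-rest
      where
      cb+n≡s : cb + suc n ≡ s
      cb+n≡s = trans (cong (cb +_) (sym (NP.+-identityʳ (suc n)))) cb+n+0≡s
      ca≡r : ca ≡ r
      ca≡r = trans (sym (NP.+-identityʳ ca)) ca+0≡r
      a≤ca : length a ≤ ca
      a≤ca = NP.≤-reflexive (trans la (sym ca≡r))
      α≡ : length α ≡ ca + suc n + cb
      α≡ = trans lα (trans (cong₂ _+_ (sym ca≡r) (sym cb+n≡s))
                   (trans (cong (ca +_) (NP.+-comm cb (suc n))) (sym (NP.+-assoc ca (suc n) cb))))
      ca+cb<α : ca + cb < length α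
      ca+cb<α = subst (ca + cb <_) (sym α≡) (NP.+-monoˡ-< cb (m+[1+n]≡o⇒m<o ca n (ca + suc n) refl))
      b-rest = length-drop-suc b cb n s lb cb+n≡s
      α-rest : length (drop (suc (ca + cb)) α) ≡ n
      α-rest = trans (LP.length-drop (suc (ca + cb)) α) (trans (cong (_∸ suc (ca + cb)) α≡) (m+[1+l]+n∸[1+m+n]≡l ca cb n))
    weight≡paperProductB (consB n {ls = ls} {ns = ns} p) ca cb ≡r ≡s =
      trans (weight-stepB ca cb n (alt A ls ns)
               (subst (ca <_) (sym la) (m+n≡o⇒m<o ca (sum ls) r ≡r (Alternating-sumᴬ p)))
               (subst (suc cb + n ≤_) (sym lb) (m+[1+l+n]≡o⇒1+m+l≤o cb n (sum ns) s ≡s))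
               (subst (ca + cb + suc n ≤_) (sym lα) (blockB-fits ca cb n (sum ns) (sum ls) r s ≡r ≡s)))
            (trans (cong (binomProd (suc n) (drop (ca + cb) α)
                (βB ca cb ∷ (blockB cb n ++ blockSeq a b α ca (cb + suc n) (alt A ls ns))) *_)
                  (weight≡paperProductA p ca (cb + suc n) ≡r (trans (NP.+-assoc cb (suc n) (sum ns)) ≡s)))
                   (sym (paperProduct-consB p ca cb n)))


prodBelow : ℕ → (ℕ → ℕ) → ℕ
prodBelow zero g = 1
prodBelow (suc m) g = g 0 * prodBelow m (λ t → g (suc t))

prodBelow-cong : ∀ m {f g : ℕ → ℕ} → (∀ t → f t ≡ g t) → prodBelow m f ≡ prodBelow m g
prodBelow-cong zero h = refl
prodBelow-cong (suc m) h = cong₂ _*_ (h 0) (prodBelow-cong m (λ t → h (suc t)))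

product-applyUpTo : ∀ m (g : ℕ → ℕ) → product (applyUpTo g m) ≡ prodBelow m g
product-applyUpTo zero g = refl
product-applyUpTo (suc m) g = cong (g 0 *_) (product-applyUpTo m (λ t → g (suc t)))

prodRange≡prodBelow : ∀ lo hi (f : ℕ → ℕ) → prodRange lo hi f ≡ prodBelow (suc hi ∸ lo) (λ t → f (lo + t))
prodRange≡prodBelow lo hi f = trans (cong product (trans (sym (LP.map-∘ (upTo (suc hi ∸ lo))))
    (LP.map-upTo _ (suc hi ∸ lo)))) (product-applyUpTo (suc hi ∸ lo) _)

prodBelow-binomProd : ∀ E α β → prodBelow E (λ t → binom (at₀ α t) (atℤ₀ β t)) ≡ binomProd E α β
prodBelow-binomProd zero α β = refl
prodBelow-binomProd (suc E) α β = cong₂ _*_ (cong₂ binom (h0 α) (hZ β))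
    (trans (prodBelow-cong E (λ t → cong₂ binom (hs α t) (hsZ β t))) (prodBelow-binomProd E (tail₀ α) (tail₀ β)))
  where
  h0 : ∀ α → at₀ α 0 ≡ head₀ α
  h0 [] = refl
  h0 (v ∷ vs) = refl
  hZ : ∀ β → atℤ₀ β 0 ≡ headℤ β
  hZ [] = refl
  hZ (v ∷ vs) = refl
  hs : ∀ α t → at₀ α (suc t) ≡ at₀ (tail₀ α) t
  hs [] t = refl
  hs (v ∷ vs) t = refl
  hsZ : ∀ β t → atℤ₀ β (suc t) ≡ atℤ₀ (tail₀ β) t
  hsZ [] t = refl
  hsZ (v ∷ vs) t = refl

prodBelow-deltaProd : ∀ E xs ys → prodBelow E (λ t → δ (at₀ xs t) (at₀ ys t)) ≡ deltaProd E xs ys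
prodBelow-deltaProd zero xs ys = refl
prodBelow-deltaProd (suc E) xs ys = cong₂ _*_ (cong₂ δ (h0 xs) (h0 ys))
    (trans (prodBelow-cong E (λ t → cong₂ δ (hs xs t) (hs ys t))) (prodBelow-deltaProd E (tail₀ xs) (tail₀ ys)))
  where
  h0 : ∀ α → at₀ α 0 ≡ head₀ α
  h0 [] = refl
  h0 (v ∷ vs) = refl
  hs : ∀ α t → at₀ α (suc t) ≡ at₀ (tail₀ α) t
  hs [] t = refl
  hs (v ∷ vs) t = refl

prodRange-binom : ∀ E α β → prodRange 1 E (λ i → binom (at α i) (atℤ β i)) ≡ binomProd E α β
prodRange-binom E α β = trans (prodRange≡prodBelow 1 E _) (trans
    (prodBelow-cong E (λ t → cong₂ binom (at-suc α t) (atℤ-suc β t))) (prodBelow-binomProd E α β))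

prodRange-δ : ∀ E R o α (w : List ℕ) → o ≤ suc E →
  prodRange (E + 2) R (λ j → δ (at α j) (at w (j ∸ o))) ≡ deltaProd (R ∸ suc E) (drop (suc E) α) (drop (suc E ∸ o) w)
prodRange-δ E R o α w o≤1+E = trans (prodRange≡prodBelow (E + 2) R _)
    (trans (cong (λ z → prodBelow (suc R ∸ z) (λ t → δ (at α (z + t)) (at w (z + t ∸ o)))) (NP.+-comm E 2))
   (trans (prodBelow-cong (R ∸ suc E) entry) (prodBelow-deltaProd (R ∸ suc E) (drop (suc E) α) (drop (suc E ∸ o) w))))
  where
  entry : ∀ t →
    δ (at α (suc (suc E) + t)) (at w (suc (suc E) + t ∸ o)) ≡ δ (at₀ (drop (suc E) α) t) (at₀ (drop (suc E ∸ o) w) t)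
  entry t = cong₂ δ (trans (at-suc α (suc E + t)) (at₀-drop (suc E) α t))
                 (trans (cong (at w) (trans (NP.+-∸-assoc 1 (NP.≤-trans o≤1+E (NP.m≤m+n (suc E) t))) (cong suc (NP.+-∸-comm t o≤1+E))))
                   (trans (at-suc w ((suc E ∸ o) + t)) (at₀-drop (suc E ∸ o) w t)))

innerLength : List (Tag × ℕ) → ℕ
innerLength [] = 0
innerLength (_ ∷ []) = 0
innerLength ((t , l) ∷ blk ∷ bs) = l + innerLength (blk ∷ bs)

drop-tail₀ : ∀ m (xs : List ℕ) → drop m (tail₀ xs) ≡ drop (suc m) xs
drop-tail₀ m [] = LP.drop-[] m
drop-tail₀ m (v ∷ vs) = refl

drop-tail₀ℤ : ∀ m (xs : List ℤ) → drop m (tail₀ xs) ≡ drop (suc m) xs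
drop-tail₀ℤ m [] = LP.drop-[] m
drop-tail₀ℤ m (v ∷ vs) = refl

binomProd-+ : ∀ m n xs ys → binomProd (m + n) xs ys ≡ binomProd m xs ys * binomProd n (drop m xs) (drop m ys)
binomProd-+ zero n xs ys = sym (NP.+-identityʳ _)
binomProd-+ (suc m) n xs ys rewrite binomProd-+ m n (tail₀ xs) (tail₀ ys) | drop-tail₀ m xs | drop-tail₀ℤ m ys =
  sym (NP.*-assoc (binom (head₀ xs) (headℤ ys)) (binomProd m (tail₀ xs) (tail₀ ys)) _)

drop-++-length : ∀ {X : Set} (Q R : List X) l → length Q ≡ l → drop l (Q ++ R) ≡ R
drop-++-length [] R zero e = refl
drop-++-length (q ∷ Q) R (suc l) e = drop-++-length Q R l (NP.suc-injective e)

-- The binomials of all blocks but the last form a single product over the first innerLength exponents,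
-- matching the paper's ∏_{i ≤ L_p + s} (and its three variants).
module Factorise (a b α : List ℕ) where
  open PaperProduct a b α
  open WeightSteps a b α

  lastFactor : ℕ → ℕ → List (Tag × ℕ) → ℕ
  lastFactor ca cb [] = 1
  lastFactor ca cb (blk ∷ []) = paperProduct ca cb (blk ∷ [])
  lastFactor ca cb ((A , l) ∷ blk ∷ bs) = lastFactor (ca + l) cb (blk ∷ bs)
  lastFactor ca cb ((B , n) ∷ blk ∷ bs) = lastFactor ca (cb + n) (blk ∷ bs)

  paperProduct-stepA : ∀ ca cb l blk bs →
    paperProduct (ca + suc l) cb (blk ∷ bs) ≡ binomProd (innerLength (blk ∷ bs)) (drop (ca + suc l + cb) α)
        (blockSeq a b α (ca + suc l) cb (blk ∷ bs)) * lastFactor (ca + suc l) cb (blk ∷ bs) →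
    paperProduct ca cb ((A , suc l) ∷ blk ∷ bs) ≡ binomProd (innerLength ((A , suc l) ∷ blk ∷ bs)) (drop (ca + cb) α)
        (blockSeq a b α ca cb ((A , suc l) ∷ blk ∷ bs)) * lastFactor ca cb ((A , suc l) ∷ blk ∷ bs)
  paperProduct-stepA ca cb l blk bs ih = begin
    firstBlock * paperProduct (ca + suc l) cb (blk ∷ bs)
      ≡⟨ cong (firstBlock *_) ih ⟩
    firstBlock * (binomProd (innerLength (blk ∷ bs)) (drop (ca + suc l + cb) α) R * lastFactor (ca + suc l) cb (blk ∷ bs))
      ≡⟨ sym (NP.*-assoc firstBlock _ _) ⟩
    firstBlock * binomProd (innerLength (blk ∷ bs)) (drop (ca + suc l + cb) α) R * lastFactor (ca + suc l) cb (blk ∷ bs)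
      ≡⟨ cong (λ z → firstBlock * binomProd (innerLength (blk ∷ bs)) z R * lastFactor (ca + suc l) cb (blk ∷ bs)) (sym drop-α′) ⟩
    firstBlock * binomProd (innerLength (blk ∷ bs)) (drop (suc l) α') R * lastFactor (ca + suc l) cb (blk ∷ bs)
      ≡⟨ cong (λ z → firstBlock * binomProd (innerLength (blk ∷ bs)) (drop (suc l) α') z * lastFactor (ca + suc l) cb (blk ∷ bs))
          (sym (drop-++-length (blockA ca l) R l (length-block-entries a ca l))) ⟩
    firstBlock * binomProd (innerLength (blk ∷ bs)) (drop (suc l) α') (drop (suc l) seq) * lastFactor (ca + suc l) cb (blk ∷ bs)
      ≡⟨ cong (_* lastFactor (ca + suc l) cb (blk ∷ bs)) (sym (binomProd-+ (suc l) (innerLength (blk ∷ bs)) α' seq)) ⟩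
    binomProd (suc l + innerLength (blk ∷ bs)) α' seq * lastFactor (ca + suc l) cb (blk ∷ bs) ∎
    where
    open ≡-Reasoning
    α' = drop (ca + cb) α
    R = blockSeq a b α (ca + suc l) cb (blk ∷ bs)
    seq = blockSeq a b α ca cb ((A , suc l) ∷ blk ∷ bs)
    firstBlock = binomProd (suc l) α' seq
    drop-α′ : drop (suc l) α' ≡ drop (ca + suc l + cb) α
    drop-α′ = trans (LP.drop-drop (ca + cb) (suc l) α) (cong (λ z → drop z α)
        (trans (NP.+-assoc ca cb (suc l)) (trans (cong (ca +_) (NP.+-comm cb (suc l)))
        (sym (NP.+-assoc ca (suc l) cb)))))

  paperProduct-stepB : ∀ ca cb n blk bs →
    paperProduct ca (cb + suc n) (blk ∷ bs) ≡ binomProd (innerLength (blk ∷ bs)) (drop (ca + (cb + suc n)) α)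
        (blockSeq a b α ca (cb + suc n) (blk ∷ bs)) * lastFactor ca (cb + suc n) (blk ∷ bs) →
    paperProduct ca cb ((B , suc n) ∷ blk ∷ bs) ≡ binomProd (innerLength ((B , suc n) ∷ blk ∷ bs)) (drop (ca + cb) α)
        (blockSeq a b α ca cb ((B , suc n) ∷ blk ∷ bs)) * lastFactor ca cb ((B , suc n) ∷ blk ∷ bs)
  paperProduct-stepB ca cb n blk bs ih = begin
    firstBlock * paperProduct ca (cb + suc n) (blk ∷ bs)
      ≡⟨ cong (firstBlock *_) ih ⟩
    firstBlock * (binomProd (innerLength (blk ∷ bs)) (drop (ca + (cb + suc n)) α) R * lastFactor ca (cb + suc n) (blk ∷ bs))
      ≡⟨ sym (NP.*-assoc firstBlock _ _) ⟩
    firstBlock * binomProd (innerLength (blk ∷ bs)) (drop (ca + (cb + suc n)) α) R * lastFactor ca (cb + suc n) (blk ∷ bs)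
      ≡⟨ cong (λ z → firstBlock * binomProd (innerLength (blk ∷ bs)) z R * lastFactor ca (cb + suc n) (blk ∷ bs)) (sym drop-α′) ⟩
    firstBlock * binomProd (innerLength (blk ∷ bs)) (drop (suc n) α') R * lastFactor ca (cb + suc n) (blk ∷ bs)
      ≡⟨ cong (λ z → firstBlock * binomProd (innerLength (blk ∷ bs)) (drop (suc n) α') z * lastFactor ca (cb + suc n) (blk ∷ bs))
          (sym (drop-++-length (blockB cb n) R n (length-block-entries b cb n))) ⟩
    firstBlock * binomProd (innerLength (blk ∷ bs)) (drop (suc n) α') (drop (suc n) seq) * lastFactor ca (cb + suc n) (blk ∷ bs)
      ≡⟨ cong (_* lastFactor ca (cb + suc n) (blk ∷ bs)) (sym (binomProd-+ (suc n) (innerLength (blk ∷ bs)) α' seq)) ⟩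
    binomProd (suc n + innerLength (blk ∷ bs)) α' seq * lastFactor ca (cb + suc n) (blk ∷ bs) ∎
    where
    open ≡-Reasoning
    α' = drop (ca + cb) α
    R = blockSeq a b α ca (cb + suc n) (blk ∷ bs)
    seq = blockSeq a b α ca cb ((B , suc n) ∷ blk ∷ bs)
    firstBlock = binomProd (suc n) α' seq
    drop-α′ : drop (suc n) α' ≡ drop (ca + (cb + suc n)) α
    drop-α′ = trans (LP.drop-drop (ca + cb) (suc n) α) (cong (λ z → drop z α) (NP.+-assoc ca cb (suc n)))

  mutual
    paperProduct-factorA : ∀ {e ls ns} → Alternating A e ls ns → ∀ ca cb →
      paperProduct ca cb (alt A ls ns) ≡ binomProd (innerLength (alt A ls ns)) (drop (ca + cb) α)
          (blockSeq a b α ca cb (alt A ls ns)) * lastFactor ca cb (alt A ls ns)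
    paperProduct-factorA (lastA l) ca cb = sym (NP.+-identityʳ _)
    paperProduct-factorA (consA l {ls = ls} (lastB n)) ca cb = paperProduct-stepA ca cb l (B , suc n) (alt A ls [])
        (paperProduct-factorB (lastB n) (ca + suc l) cb)
    paperProduct-factorA (consA l {ls = ls} (consB n {ns = ns} p)) ca cb = paperProduct-stepA ca cb l (B , suc n)
        (alt A ls ns) (paperProduct-factorB (consB n p) (ca + suc l) cb)

    paperProduct-factorB : ∀ {e ls ns} → Alternating B e ls ns → ∀ ca cb →
      paperProduct ca cb (alt B ls ns) ≡ binomProd (innerLength (alt B ls ns)) (drop (ca + cb) α)
          (blockSeq a b α ca cb (alt B ls ns)) * lastFactor ca cb (alt B ls ns)
    paperProduct-factorB (lastB n) ca cb = sym (NP.+-identityʳ _)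
    paperProduct-factorB (consB n {ns = ns} (lastA l)) ca cb = paperProduct-stepB ca cb n (A , suc l) (alt B [] ns)
        (paperProduct-factorA (lastA l) ca (cb + suc n))
    paperProduct-factorB (consB n {ns = ns} (consA l {ls = ls} p)) ca cb = paperProduct-stepB ca cb n (A , suc l)
        (alt B ls ns) (paperProduct-factorA (consA l p) ca (cb + suc n))


initSum : List ℕ → ℕ
initSum ls = sumTo ls (length ls ∸ 1)

last₀ : List ℕ → ℕ
last₀ [] = 0
last₀ (q ∷ []) = q
last₀ (q ∷ q2 ∷ qs) = last₀ (q2 ∷ qs)

sum≡initSum+last₀ : ∀ q qs → sum (q ∷ qs) ≡ initSum (q ∷ qs) + last₀ (q ∷ qs)
sum≡initSum+last₀ q [] = NP.+-comm q 0
sum≡initSum+last₀ q (q2 ∷ qs) rewrite sum≡initSum+last₀ q2 qs = sym (NP.+-assoc q _ _)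

mutual
  innerLength-AA : ∀ {ls ns} → Alternating A A ls ns → innerLength (alt A ls ns) ≡ initSum ls + sum ns
  innerLength-AA (lastA l) = refl
  innerLength-AA (consA l {ls = ls} (consB n {ns = ns} (lastA l′))) = trans
      (cong (suc l +_) (innerLength-BA (consB n (lastA l′)))) (sym (NP.+-assoc (suc l) (initSum ls) (sum (suc n ∷ ns))))
  innerLength-AA (consA l {ls = ls} (consB n {ns = ns} (consA l′ p))) = trans
      (cong (suc l +_) (innerLength-BA (consB n (consA l′ p))))
      (sym (NP.+-assoc (suc l) (initSum ls) (sum (suc n ∷ ns))))
  innerLength-BA : ∀ {ls ns} → Alternating B A ls ns → innerLength (alt B ls ns) ≡ initSum ls + sum ns
  innerLength-BA (consB n {ls = ls} {ns = ns} (lastA l)) = trans (cong (suc n +_) (innerLength-AA (lastA l)))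
      (m+[n+o]≡n+[m+o] (suc n) (initSum ls) (sum ns))
  innerLength-BA (consB n {ls = ls} {ns = ns} (consA l p)) = trans (cong (suc n +_) (innerLength-AA (consA l p)))
      (m+[n+o]≡n+[m+o] (suc n) (initSum ls) (sum ns))

mutual
  innerLength-BB : ∀ {ls ns} → Alternating B B ls ns → innerLength (alt B ls ns) ≡ sum ls + initSum ns
  innerLength-BB (lastB n) = refl
  innerLength-BB (consB n {ns = ns} (consA l {ls = ls} (lastB n′))) = trans
      (cong (suc n +_) (innerLength-AB (consA l (lastB n′)))) (m+[n+o]≡n+[m+o] (suc n) (sum (suc l ∷ ls)) (initSum ns))
  innerLength-BB (consB n {ns = ns} (consA l {ls = ls} (consB n′ p))) = trans
      (cong (suc n +_) (innerLength-AB (consA l (consB n′ p))))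
      (m+[n+o]≡n+[m+o] (suc n) (sum (suc l ∷ ls)) (initSum ns))
  innerLength-AB : ∀ {ls ns} → Alternating A B ls ns → innerLength (alt A ls ns) ≡ sum ls + initSum ns
  innerLength-AB (consA l {ls = ls} {ns = ns} (lastB n)) = trans (cong (suc l +_) (innerLength-BB (lastB n)))
      (sym (NP.+-assoc (suc l) (sum ls) (initSum ns)))
  innerLength-AB (consA l {ls = ls} {ns = ns} (consB n p)) = trans (cong (suc l +_) (innerLength-BB (consB n p)))
      (sym (NP.+-assoc (suc l) (sum ls) (initSum ns)))

module LastFactor (a b α : List ℕ) where
  open PaperProduct a b α
  open Factorise a b α

  mutual
    lastFactor-AA : ∀ {ls ns} → Alternating A A ls ns → ∀ ca cb →
      lastFactor ca cb (alt A ls ns) ≡ paperProduct (ca + initSum ls) (cb + sum ns) ((A , last₀ ls) ∷ [])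
    lastFactor-AA (lastA l) ca cb = cong₂ (λ p q → paperProduct p q ((A , suc l) ∷ [])) (sym (NP.+-identityʳ ca)) (sym (NP.+-identityʳ cb))
    lastFactor-AA (consA l {ls = ls} (consB n {ns = ns} (lastA l′))) ca cb = trans
        (lastFactor-BA (consB n (lastA l′)) (ca + suc l) cb)
        (cong (λ z → paperProduct z (cb + sum (suc n ∷ ns)) ((A , last₀ ls) ∷ [])) (NP.+-assoc ca (suc l) (initSum ls)))
    lastFactor-AA (consA l {ls = ls} (consB n {ns = ns} (consA l′ p))) ca cb = trans
        (lastFactor-BA (consB n (consA l′ p)) (ca + suc l) cb)
        (cong (λ z → paperProduct z (cb + sum (suc n ∷ ns)) ((A , last₀ ls) ∷ [])) (NP.+-assoc ca (suc l) (initSum ls)))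
    lastFactor-BA : ∀ {ls ns} → Alternating B A ls ns → ∀ ca cb →
      lastFactor ca cb (alt B ls ns) ≡ paperProduct (ca + initSum ls) (cb + sum ns) ((A , last₀ ls) ∷ [])
    lastFactor-BA (consB n {ls = ls} {ns = ns} (lastA l)) ca cb = trans (lastFactor-AA (lastA l) ca (cb + suc n))
        (cong (λ z → paperProduct (ca + initSum ls) z ((A , last₀ ls) ∷ [])) (NP.+-assoc cb (suc n) (sum ns)))
    lastFactor-BA (consB n {ls = ls} {ns = ns} (consA l p)) ca cb = trans (lastFactor-AA (consA l p) ca (cb + suc n))
        (cong (λ z → paperProduct (ca + initSum ls) z ((A , last₀ ls) ∷ [])) (NP.+-assoc cb (suc n) (sum ns)))

  mutual
    lastFactor-BB : ∀ {ls ns} → Alternating B B ls ns → ∀ ca cb →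
      lastFactor ca cb (alt B ls ns) ≡ paperProduct (ca + sum ls) (cb + initSum ns) ((B , last₀ ns) ∷ [])
    lastFactor-BB (lastB n) ca cb = cong₂ (λ p q → paperProduct p q ((B , suc n) ∷ [])) (sym (NP.+-identityʳ ca)) (sym (NP.+-identityʳ cb))
    lastFactor-BB (consB n {ns = ns} (consA l {ls = ls} (lastB n′))) ca cb = trans
        (lastFactor-AB (consA l (lastB n′)) ca (cb + suc n))
        (cong (λ z → paperProduct (ca + sum (suc l ∷ ls)) z ((B , last₀ ns) ∷ [])) (NP.+-assoc cb (suc n) (initSum ns)))
    lastFactor-BB (consB n {ns = ns} (consA l {ls = ls} (consB n′ p))) ca cb = trans
        (lastFactor-AB (consA l (consB n′ p)) ca (cb + suc n))
        (cong (λ z → paperProduct (ca + sum (suc l ∷ ls)) z ((B , last₀ ns) ∷ [])) (NP.+-assoc cb (suc n) (initSum ns)))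
    lastFactor-AB : ∀ {ls ns} → Alternating A B ls ns → ∀ ca cb →
      lastFactor ca cb (alt A ls ns) ≡ paperProduct (ca + sum ls) (cb + initSum ns) ((B , last₀ ns) ∷ [])
    lastFactor-AB (consA l {ls = ls} {ns = ns} (lastB n)) ca cb = trans (lastFactor-BB (lastB n) (ca + suc l) cb)
        (cong (λ z → paperProduct z (cb + initSum ns) ((B , last₀ ns) ∷ [])) (NP.+-assoc ca (suc l) (sum ls)))
    lastFactor-AB (consA l {ls = ls} {ns = ns} (consB n p)) ca cb = trans (lastFactor-BB (consB n p) (ca + suc l) cb)
        (cong (λ z → paperProduct z (cb + initSum ns) ((B , last₀ ns) ∷ [])) (NP.+-assoc ca (suc l) (sum ls)))


Positive : List ℕ → Set
Positive = All (λ q → 1 ≤ q)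

mutual
  alternating-AA : ∀ ls ns → Positive ls → Positive ns → length ls ≡ suc (length ns) → Alternating A A ls ns
  alternating-AA (suc l ∷ []) [] (s≤s z≤n ∷ []) [] e = lastA l
  alternating-AA (suc l ∷ q ∷ ls) [] (s≤s z≤n ∷ pl) [] ()
  alternating-AA (suc l ∷ ls) (n ∷ ns) (s≤s z≤n ∷ pl) pn e = consA l (alternating-BA ls n ns pl pn (NP.suc-injective e))

  alternating-BA : ∀ ls n ns → Positive ls → Positive (n ∷ ns) → length ls ≡ length (n ∷ ns) → Alternating B A ls (n ∷ ns)
  alternating-BA ls (suc n) ns pl (s≤s z≤n ∷ pn) e = consB n (alternating-AA ls ns pl pn e)

mutual
  alternating-AB : ∀ l ls ns → Positive (l ∷ ls) → Positive ns → length (l ∷ ls) ≡ length ns → Alternating A B (l ∷ ls) ns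
  alternating-AB (suc l) ls ns (s≤s z≤n ∷ pl) pn e = consA l (alternating-BB ls ns pl pn (sym e))

  alternating-BB : ∀ ls ns → Positive ls → Positive ns → length ns ≡ suc (length ls) → Alternating B B ls ns
  alternating-BB [] (suc n ∷ []) [] (s≤s z≤n ∷ []) e = lastB n
  alternating-BB [] (suc n ∷ q ∷ ns) [] (s≤s z≤n ∷ pn) ()
  alternating-BB (l ∷ ls) (suc n ∷ ns) pl (s≤s z≤n ∷ pn) e = consB n (alternating-AB l ls ns pl pn (sym (NP.suc-injective e)))

sumComp-cong-positive : ∀ n {f g : List ℕ → ℕ} → (∀ ls → Positive ls → sum ls ≡ n → f ls ≡ g ls) → sumComp n f ≡ sumComp n g
sumComp-cong-positive zero h = h [] [] refl
sumComp-cong-positive (suc n) {f} {g} h = cong₂ _+_ (sumComp-cong-positive n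
    (λ ls p e → h (1 ∷ ls) (s≤s z≤n ∷ p) (cong suc e))) (sumComp-cong-positive n bumped)
  where
  bumped : ∀ ls → Positive ls → sum ls ≡ n → bumpHead f ls ≡ bumpHead g ls
  bumped [] p e = refl
  bumped (l ∷ ls) (_ ∷ p) e = h (suc l ∷ ls) (s≤s z≤n ∷ p) (cong suc e)

≡ᵇ-true⇒≡ : ∀ m n → (m ≡ᵇ n) ≡ true → m ≡ n
≡ᵇ-true⇒≡ zero zero e = refl
≡ᵇ-true⇒≡ (suc m) (suc n) e = cong suc (≡ᵇ-true⇒≡ m n e)

≡ᵇ-comm : ∀ m n → (m ≡ᵇ n) ≡ (n ≡ᵇ m)
≡ᵇ-comm zero zero = refl
≡ᵇ-comm zero (suc n) = refl
≡ᵇ-comm (suc m) zero = refl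
≡ᵇ-comm (suc m) (suc n) = ≡ᵇ-comm m n

[m+n]∸[1+m]≡n∸1 : ∀ m n → (m + n) ∸ suc m ≡ n ∸ 1
[m+n]∸[1+m]≡n∸1 m n = trans (cong ((m + n) ∸_) (NP.+-comm 1 m)) (trans (sym (NP.∸-+-assoc (m + n) m 1)) (cong (_∸ 1) (NP.m+n∸m≡n m n)))

βA-0-0 : ∀ a1 a' b α → PaperProduct.βA (a1 ∷ a') b α 0 0 ≡ ℤ.+ a1
βA-0-0 a1 a' b α = trans (ZP.+-identityʳ _) (cong toℤ (trans (NP.+-identityʳ _) (NP.+-identityʳ a1)))

βB-0-0 : ∀ a b1 b' α → PaperProduct.βB a (b1 ∷ b') α 0 0 ≡ ℤ.+ b1
βB-0-0 a b1 b' α = trans (ZP.+-identityʳ _) (cong toℤ (NP.+-identityʳ b1))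

weight≡paperProduct-A : ∀ r s a1 a' b α →
  (la : length (a1 ∷ a') ≡ r) (lb : length b ≡ s) (lα : length α ≡ r + s) → ∀ {e ls ns} →
  (p : Alternating A e ls ns) → sum ls ≡ r → sum ns ≡ s →
  weight (map toℤ (a1 ∷ a')) (map toℤ b) α (alt A ls ns) ≡ PaperProduct.paperProduct (a1 ∷ a') b α 0 0 (alt A ls ns)
weight≡paperProduct-A r s a1 a' b α la lb lα {ls = ls} {ns = ns} p Σls≡r Σns≡s = trans
    (cong (λ h → weight (h ∷ map toℤ a') (map toℤ b) α (alt A ls ns)) (sym (βA-0-0 a1 a' b α)))
    (WeightIsPaperProduct.weight≡paperProductA r s (a1 ∷ a') b α la lb lα p 0 0 Σls≡r Σns≡s)

weight≡paperProduct-B : ∀ r s a b1 b' α →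
  (la : length a ≡ r) (lb : length (b1 ∷ b') ≡ s) (lα : length α ≡ r + s) → ∀ {e ls ns} →
  (p : Alternating B e ls ns) → sum ls ≡ r → sum ns ≡ s →
  weight (map toℤ a) (map toℤ (b1 ∷ b')) α (alt B ls ns) ≡ PaperProduct.paperProduct a (b1 ∷ b') α 0 0 (alt B ls ns)
weight≡paperProduct-B r s a b1 b' α la lb lα {ls = ls} {ns = ns} p Σls≡r Σns≡s = trans
    (cong (λ h → weight (map toℤ a) (h ∷ map toℤ b') α (alt B ls ns)) (sym (βB-0-0 a b1 b' α)))
    (WeightIsPaperProduct.weight≡paperProductB r s a (b1 ∷ b') α la lb lα p 0 0 Σls≡r Σns≡s)

lastBlockδ-A : ∀ Ei L s (a b α : List ℕ) (β : List ℤ) →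
  binomProd (Ei + s) α β * deltaProd (((Ei + L) + s) ∸ suc (Ei + s)) (drop (suc (Ei + s)) α) (drop (suc (Ei + s) ∸ s) a)
  ≡ binomProd (Ei + s) α β * PaperProduct.paperProduct a b α (0 + Ei) (0 + s) ((A , L) ∷ [])
lastBlockδ-A Ei L s a b α β = cong (binomProd (Ei + s) α β *_) (cong₂ (λ m w → deltaProd m (drop (suc (Ei + s)) α) w)
  (trans (cong (_∸ suc (Ei + s)) (trans (NP.+-assoc Ei L s) (trans (cong (Ei +_) (NP.+-comm L s))
      (sym (NP.+-assoc Ei s L))))) ([m+n]∸[1+m]≡n∸1 (Ei + s) L))
  (cong (λ z → drop z a) (NP.m+n∸n≡m (suc Ei) s)))

lastBlockδ-B : ∀ Ei L r (a b α : List ℕ) (β : List ℤ) →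
  binomProd (r + Ei) α β * deltaProd ((r + (Ei + L)) ∸ suc (r + Ei)) (drop (suc (r + Ei)) α) (drop (suc (r + Ei) ∸ r) b)
  ≡ binomProd (r + Ei) α β * PaperProduct.paperProduct a b α (0 + r) (0 + Ei) ((B , L) ∷ [])
lastBlockδ-B Ei L r a b α β = cong (binomProd (r + Ei) α β *_) (cong₂ (λ m w → deltaProd m (drop (suc (r + Ei)) α) w)
  (trans (cong (_∸ suc (r + Ei)) (sym (NP.+-assoc r Ei L))) ([m+n]∸[1+m]≡n∸1 (r + Ei) L))
  (cong (λ z → drop z b) (trans (cong (_∸ r) (sym (NP.+-suc r Ei))) (NP.m+n∸m≡n r (suc Ei)))))

ind-∧-true : ∀ c X Y → (c ≡ true → X ≡ Y) → ind (c ∧ true) X ≡ toℕ c * Y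
ind-∧-true true X Y h = trans (h refl) (sym (NP.+-identityʳ Y))
ind-∧-true false X Y h = refl

term₁≡weight : ∀ r s a1 a' b α → length (a1 ∷ a') ≡ r → length b ≡ s → length α ≡ r + s → ∀ ls n ns →
  Positive ls → Positive (n ∷ ns) → sum ls ≡ r → sum (n ∷ ns) ≡ s →
  term₁ r s (a1 ∷ a') b α ls (n ∷ ns) ≡ toℕ (length ls ≡ᵇ suc (length (n ∷ ns))) * weight (map toℤ (a1 ∷ a'))
      (map toℤ b) α (alt A ls (n ∷ ns))
term₁≡weight r s a1 a' b α la lb lα [] n ns pl pn Σls≡r Σns≡s = refl
term₁≡weight r s a1 a' b α la lb lα (l0 ∷ ls0) n ns pl pn Σls≡r Σns≡s = ind-∧-true _ _ _ summand
  where
  a = a1 ∷ a'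
  ls = l0 ∷ ls0
  nsf = n ∷ ns
  β = βseq a b α ls nsf
  Lp = sumTo ls (length nsf)
  summand : (length ls ≡ᵇ suc (length nsf)) ≡ true → _ ≡ weight (map toℤ a) (map toℤ b) α (alt A ls nsf)
  summand len≡ = begin
    prodRange 1 (Lp + s) (λ i → binom (at α i) (atℤ β i)) * prodRange (Lp + s + 2) (r + s) (λ j → δ (at α j) (at a (j ∸ s)))
      ≡⟨ cong₂ _*_ (prodRange-binom (Lp + s) α β) (prodRange-δ (Lp + s) (r + s) s α a (NP.≤-trans (NP.m≤n+m s Lp) (NP.n≤1+n _))) ⟩
    binomProd (Lp + s) α β * deltaProd ((r + s) ∸ suc (Lp + s)) (drop (suc (Lp + s)) α) (drop (suc (Lp + s) ∸ s) a)
      ≡⟨ cong₂ (λ E R → binomProd (E + s) α β * deltaProd ((R + s) ∸ suc (E + s)) (drop (suc (E + s)) α)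
          (drop (suc (E + s) ∸ s) a)) eLp eR ⟩
    binomProd (Ei + s) α β * deltaProd (((Ei + L) + s) ∸ suc (Ei + s)) (drop (suc (Ei + s)) α) (drop (suc (Ei + s) ∸ s) a)
      ≡⟨ lastBlockδ-A Ei L s a b α β ⟩
    binomProd (Ei + s) α β * PaperProduct.paperProduct a b α (0 + Ei) (0 + s) ((A , L) ∷ [])
      ≡⟨ cong₂ _*_ (cong (λ E → binomProd E α β) (sym (trans (innerLength-AA p) (cong (Ei +_) Σns≡s))))
          (sym (trans (LastFactor.lastFactor-AA a b α p 0 0)
          (cong (λ z → PaperProduct.paperProduct a b α (0 + Ei) z ((A , L) ∷ [])) Σns≡s))) ⟩
    binomProd (innerLength (alt A ls nsf)) α β * Factorise.lastFactor a b α 0 0 (alt A ls nsf)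
      ≡⟨ sym (Factorise.paperProduct-factorA a b α p 0 0) ⟩
    PaperProduct.paperProduct a b α 0 0 (alt A ls nsf)
      ≡⟨ sym (weight≡paperProduct-A r s a1 a' b α la lb lα p Σls≡r Σns≡s) ⟩
    weight (map toℤ a) (map toℤ b) α (alt A ls nsf) ∎
    where
    open ≡-Reasoning
    length≡ : length ls ≡ suc (length nsf)
    length≡ = ≡ᵇ-true⇒≡ (length ls) (suc (length nsf)) len≡
    p : Alternating A A ls nsf
    p = alternating-AA ls nsf pl pn length≡
    Ei = initSum ls
    L = last₀ ls
    eLp : Lp ≡ Ei
    eLp = cong (λ k → sumTo ls (k ∸ 1)) (sym length≡)
    eR : r ≡ Ei + L
    eR = trans (sym Σls≡r) (sum≡initSum+last₀ l0 ls0)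

term₂≡weight : ∀ r s a1 a' b α → length (a1 ∷ a') ≡ r → length b ≡ s → length α ≡ r + s → ∀ l0 ls0 ns →
  Positive (l0 ∷ ls0) → Positive ns → sum (l0 ∷ ls0) ≡ r → sum ns ≡ s →
  term₂ r s (a1 ∷ a') b α (l0 ∷ ls0) ns ≡ toℕ (length ns ≡ᵇ length (l0 ∷ ls0)) * weight (map toℤ (a1 ∷ a')) (map toℤ b)
      α (alt A (l0 ∷ ls0) ns)
term₂≡weight r s a1 a' b α la lb lα l0 ls0 [] pl pn Σls≡r Σns≡s = refl
term₂≡weight r s a1 a' b α la lb lα l0 ls0 (n0 ∷ ns0) pl pn Σls≡r Σns≡s = ind-∧-true _ _ _ summand
  where
  a = a1 ∷ a'
  ls = l0 ∷ ls0
  ns = n0 ∷ ns0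
  β = βseq a b α ls ns
  N = sumTo ns (length ls ∸ 1)
  summand : (length ns ≡ᵇ length ls) ≡ true → _ ≡ weight (map toℤ a) (map toℤ b) α (alt A ls ns)
  summand len≡ = begin
    prodRange 1 (r + N) (λ i → binom (at α i) (atℤ β i)) * prodRange (r + N + 2) (r + s) (λ j → δ (at α j) (at b (j ∸ r)))
      ≡⟨ cong₂ _*_ (prodRange-binom (r + N) α β) (prodRange-δ (r + N) (r + s) r α b (NP.≤-trans (NP.m≤m+n r N) (NP.n≤1+n _))) ⟩
    binomProd (r + N) α β * deltaProd ((r + s) ∸ suc (r + N)) (drop (suc (r + N)) α) (drop (suc (r + N) ∸ r) b)
      ≡⟨ cong₂ (λ E S → binomProd (r + E) α β * deltaProd ((r + S) ∸ suc (r + E)) (drop (suc (r + E)) α) (drop (suc (r + E) ∸ r) b)) eN eS ⟩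
    binomProd (r + Ei) α β * deltaProd ((r + (Ei + L)) ∸ suc (r + Ei)) (drop (suc (r + Ei)) α) (drop (suc (r + Ei) ∸ r) b)
      ≡⟨ lastBlockδ-B Ei L r a b α β ⟩
    binomProd (r + Ei) α β * PaperProduct.paperProduct a b α (0 + r) (0 + Ei) ((B , L) ∷ [])
      ≡⟨ cong₂ _*_ (cong (λ E → binomProd E α β) (sym (trans (innerLength-AB p) (cong (_+ Ei) Σls≡r))))
          (sym (trans (LastFactor.lastFactor-AB a b α p 0 0)
          (cong (λ z → PaperProduct.paperProduct a b α z (0 + Ei) ((B , L) ∷ [])) Σls≡r))) ⟩
    binomProd (innerLength (alt A ls ns)) α β * Factorise.lastFactor a b α 0 0 (alt A ls ns)
      ≡⟨ sym (Factorise.paperProduct-factorA a b α p 0 0) ⟩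
    PaperProduct.paperProduct a b α 0 0 (alt A ls ns)
      ≡⟨ sym (weight≡paperProduct-A r s a1 a' b α la lb lα p Σls≡r Σns≡s) ⟩
    weight (map toℤ a) (map toℤ b) α (alt A ls ns) ∎
    where
    open ≡-Reasoning
    length≡ : length ns ≡ length ls
    length≡ = ≡ᵇ-true⇒≡ (length ns) (length ls) len≡
    p : Alternating A B ls ns
    p = alternating-AB l0 ls0 ns pl pn (sym length≡)
    Ei = initSum ns
    L = last₀ ns
    eN : N ≡ Ei
    eN = cong (λ k → sumTo ns (k ∸ 1)) (sym length≡)
    eS : s ≡ Ei + L
    eS = trans (sym Σns≡s) (sum≡initSum+last₀ n0 ns0)

term₃≡weight : ∀ r s a b1 b' α → length a ≡ r → length (b1 ∷ b') ≡ s → length α ≡ r + s → ∀ l0 ls0 ns →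
  Positive (l0 ∷ ls0) → Positive ns → sum (l0 ∷ ls0) ≡ r → sum ns ≡ s →
  term₃ r s a (b1 ∷ b') α (l0 ∷ ls0) ns ≡ toℕ (length ns ≡ᵇ suc (length (l0 ∷ ls0))) * weight (map toℤ a)
      (map toℤ (b1 ∷ b')) α (alt B (l0 ∷ ls0) ns)
term₃≡weight r s a b1 b' α la lb lα l0 ls0 [] pl pn Σls≡r Σns≡s = refl
term₃≡weight r s a b1 b' α la lb lα l0 ls0 (n0 ∷ ns0) pl pn Σls≡r Σns≡s = ind-∧-true _ _ _ summand
  where
  b = b1 ∷ b'
  ls = l0 ∷ ls0
  ns = n0 ∷ ns0
  γ = γseq a b α ls ns
  Np = sumTo ns (length ls)
  summand : (length ns ≡ᵇ suc (length ls)) ≡ true → _ ≡ weight (map toℤ a) (map toℤ b) α (alt B ls ns)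
  summand len≡ = begin
    prodRange 1 (r + Np) (λ i → binom (at α i) (atℤ γ i)) * prodRange (r + Np + 2) (r + s) (λ j → δ (at α j) (at b (j ∸ r)))
      ≡⟨ cong₂ _*_ (prodRange-binom (r + Np) α γ) (prodRange-δ (r + Np) (r + s) r α b (NP.≤-trans (NP.m≤m+n r Np) (NP.n≤1+n _))) ⟩
    binomProd (r + Np) α γ * deltaProd ((r + s) ∸ suc (r + Np)) (drop (suc (r + Np)) α) (drop (suc (r + Np) ∸ r) b)
      ≡⟨ cong₂ (λ E S → binomProd (r + E) α γ * deltaProd ((r + S) ∸ suc (r + E)) (drop (suc (r + E)) α) (drop (suc (r + E) ∸ r) b)) eN eS ⟩
    binomProd (r + Ei) α γ * deltaProd ((r + (Ei + L)) ∸ suc (r + Ei)) (drop (suc (r + Ei)) α) (drop (suc (r + Ei) ∸ r) b)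
      ≡⟨ lastBlockδ-B Ei L r a b α γ ⟩
    binomProd (r + Ei) α γ * PaperProduct.paperProduct a b α (0 + r) (0 + Ei) ((B , L) ∷ [])
      ≡⟨ cong₂ _*_ (cong (λ E → binomProd E α γ) (sym (trans (innerLength-BB p) (cong (_+ Ei) Σls≡r))))
          (sym (trans (LastFactor.lastFactor-BB a b α p 0 0)
          (cong (λ z → PaperProduct.paperProduct a b α z (0 + Ei) ((B , L) ∷ [])) Σls≡r))) ⟩
    binomProd (innerLength (alt B ls ns)) α γ * Factorise.lastFactor a b α 0 0 (alt B ls ns)
      ≡⟨ sym (Factorise.paperProduct-factorB a b α p 0 0) ⟩
    PaperProduct.paperProduct a b α 0 0 (alt B ls ns)
      ≡⟨ sym (weight≡paperProduct-B r s a b1 b' α la lb lα p Σls≡r Σns≡s) ⟩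
    weight (map toℤ a) (map toℤ b) α (alt B ls ns) ∎
    where
    open ≡-Reasoning
    length≡ : length ns ≡ suc (length ls)
    length≡ = ≡ᵇ-true⇒≡ (length ns) (suc (length ls)) len≡
    p : Alternating B B ls ns
    p = alternating-BB ls ns pl pn length≡
    Ei = initSum ns
    L = last₀ ns
    eN : Np ≡ Ei
    eN = cong (λ k → sumTo ns (k ∸ 1)) (sym length≡)
    eS : s ≡ Ei + L
    eS = trans (sym Σns≡s) (sum≡initSum+last₀ n0 ns0)

term₄≡weight : ∀ r s a b1 b' α → length a ≡ r → length (b1 ∷ b') ≡ s → length α ≡ r + s → ∀ l0 ls0 ns →
  Positive (l0 ∷ ls0) → Positive ns → sum (l0 ∷ ls0) ≡ r → sum ns ≡ s →
  term₄ r s a (b1 ∷ b') α (l0 ∷ ls0) ns ≡ toℕ (length ns ≡ᵇ length (l0 ∷ ls0)) * weight (map toℤ a) (map toℤ (b1 ∷ b'))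
      α (alt B (l0 ∷ ls0) ns)
term₄≡weight r s a b1 b' α la lb lα l0 ls0 [] pl pn Σls≡r Σns≡s = refl
term₄≡weight r s a b1 b' α la lb lα l0 ls0 (n0 ∷ ns0) pl pn Σls≡r Σns≡s = ind-∧-true _ _ _ summand
  where
  b = b1 ∷ b'
  ls = l0 ∷ ls0
  ns = n0 ∷ ns0
  γ = γseq a b α ls ns
  Lq = sumTo ls (length ls ∸ 1)
  summand : (length ns ≡ᵇ length ls) ≡ true → _ ≡ weight (map toℤ a) (map toℤ b) α (alt B ls ns)
  summand len≡ = begin
    prodRange 1 (Lq + s) (λ i → binom (at α i) (atℤ γ i)) * prodRange (Lq + s + 2) (r + s) (λ j → δ (at α j) (at a (j ∸ s)))
      ≡⟨ cong₂ _*_ (prodRange-binom (Lq + s) α γ) (prodRange-δ (Lq + s) (r + s) s α a (NP.≤-trans (NP.m≤n+m s Lq) (NP.n≤1+n _))) ⟩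
    binomProd (Lq + s) α γ * deltaProd ((r + s) ∸ suc (Lq + s)) (drop (suc (Lq + s)) α) (drop (suc (Lq + s) ∸ s) a)
      ≡⟨ cong (λ R → binomProd (Lq + s) α γ * deltaProd ((R + s) ∸ suc (Lq + s)) (drop (suc (Lq + s)) α) (drop (suc (Lq + s) ∸ s) a)) eR ⟩
    binomProd (Lq + s) α γ * deltaProd (((Lq + L) + s) ∸ suc (Lq + s)) (drop (suc (Lq + s)) α) (drop (suc (Lq + s) ∸ s) a)
      ≡⟨ lastBlockδ-A Lq L s a b α γ ⟩
    binomProd (Lq + s) α γ * PaperProduct.paperProduct a b α (0 + Lq) (0 + s) ((A , L) ∷ [])
      ≡⟨ cong₂ _*_ (cong (λ E → binomProd E α γ) (sym (trans (innerLength-BA p) (cong (Lq +_) Σns≡s))))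
          (sym (trans (LastFactor.lastFactor-BA a b α p 0 0)
          (cong (λ z → PaperProduct.paperProduct a b α (0 + Lq) z ((A , L) ∷ [])) Σns≡s))) ⟩
    binomProd (innerLength (alt B ls ns)) α γ * Factorise.lastFactor a b α 0 0 (alt B ls ns)
      ≡⟨ sym (Factorise.paperProduct-factorB a b α p 0 0) ⟩
    PaperProduct.paperProduct a b α 0 0 (alt B ls ns)
      ≡⟨ sym (weight≡paperProduct-B r s a b1 b' α la lb lα p Σls≡r Σns≡s) ⟩
    weight (map toℤ a) (map toℤ b) α (alt B ls ns) ∎
    where
    open ≡-Reasoning
    length≡ : length ns ≡ length ls
    length≡ = ≡ᵇ-true⇒≡ (length ns) (length ls) len≡
    p : Alternating B A ls ns
    p = alternating-BA ls n0 ns0 pl pn (sym length≡)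
    L = last₀ ls
    eR : r ≡ Lq + L
    eR = trans (sym Σls≡r) (sum≡initSum+last₀ l0 ls0)


sum≡sumOver-id : ∀ L → sum L ≡ sumOver (λ z → z) L
sum≡sumOver-id [] = refl
sum≡sumOver-id (q ∷ L) = cong (q +_) (sum≡sumOver-id L)

sumComps≡sumComp : ∀ r s f → sumComps r s f ≡ sumComp r (λ ls → sumComp s (f ls))
sumComps≡sumComp r s f = begin
  sum (concatMap (λ ls → map (f ls) (compositions s)) (compositions r))
    ≡⟨ sum≡sumOver-id (concatMap (λ ls → map (f ls) (compositions s)) (compositions r)) ⟩
  sumOver (λ z → z) (concatMap (λ ls → map (f ls) (compositions s)) (compositions r))
    ≡⟨ sumOver-concatMap (λ z → z) (λ ls → map (f ls) (compositions s)) (compositions r) ⟩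
  sumOver (λ ls → sumOver (λ z → z) (map (f ls) (compositions s))) (compositions r)
    ≡⟨ sumOver-cong (compositions r) (λ ls → trans (sumOver-map (λ z → z) (f ls) (compositions s)) (sumOver-compositions s (f ls))) ⟩
  sumOver (λ ls → sumComp s (f ls)) (compositions r)
    ≡⟨ sumOver-compositions r _ ⟩
  sumComp r (λ ls → sumComp s (f ls)) ∎
  where open ≡-Reasoning

0≡r⇒1≰r : ∀ {r} → 0 ≡ r → 1 ≤ r → ⊥
0≡r⇒1≰r refl ()

sumComp²-split : ∀ r s (c₁ c₂ W : List ℕ → List ℕ → ℕ) →
  sumComp r (λ ls → sumComp s (λ ns → (c₁ ls ns + c₂ ls ns) * W ls ns))
  ≡ sumComp r (λ ls → sumComp s (λ ns → c₁ ls ns * W ls ns)) + sumComp r (λ ls → sumComp s (λ ns → c₂ ls ns * W ls ns))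
sumComp²-split r s c₁ c₂ W =
  trans (sumComp-cong r (λ ls → trans (sumComp-cong s (λ ns → NP.*-distribʳ-+ (W ls ns) (c₁ ls ns) (c₂ ls ns)))
                                      (sumComp-+ s (λ ns → c₁ ls ns * W ls ns) (λ ns → c₂ ls ns * W ls ns))))
        (sumComp-+ r _ _)

module _ (r s : ℕ) (1≤r : 1 ≤ r) (1≤s : 1 ≤ s) (a₁ b₁ : ℕ) (a′ b′ γ : List ℕ)
         (la : length (a₁ ∷ a′) ≡ r) (lb : length (b₁ ∷ b′) ≡ s) (lγ : length γ ≡ r + s) where

  private
    as bs : List ℕ
    as = a₁ ∷ a′
    bs = b₁ ∷ b′
    WA WB : List ℕ → List ℕ → ℕ
    WA ls ns = weight (map toℤ as) (map toℤ bs) γ (alt A ls ns)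
    WB ls ns = weight (map toℤ as) (map toℤ bs) γ (alt B ls ns)

  sumComps-term₁ : sumComps r s (term₁ r s as bs γ)
                 ≡ sumComp r (λ ls → sumComp s (λ ns → toℕ (length ls ≡ᵇ suc (length ns)) * WA ls ns))
  sumComps-term₁ = trans (sumComps≡sumComp r s _) (sumComp-cong-positive r (λ ls pl e₁ → sumComp-cong-positive s (on ls pl e₁)))
    where
    on : ∀ ls → Positive ls → sum ls ≡ r → ∀ ns → Positive ns → sum ns ≡ s → _
    on ls pl e₁ [] pn e₂ = ⊥-elim (0≡r⇒1≰r e₂ 1≤s)
    on ls pl e₁ (n ∷ ns) pn e₂ = term₁≡weight r s a₁ a′ bs γ la lb lγ ls n ns pl pn e₁ e₂

  sumComps-term₂ : sumComps r s (term₂ r s as bs γ)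
                 ≡ sumComp r (λ ls → sumComp s (λ ns → toℕ (length ns ≡ᵇ length ls) * WA ls ns))
  sumComps-term₂ = trans (sumComps≡sumComp r s _) (sumComp-cong-positive r (λ ls pl e₁ → sumComp-cong-positive s (on ls pl e₁)))
    where
    on : ∀ ls → Positive ls → sum ls ≡ r → ∀ ns → Positive ns → sum ns ≡ s → _
    on [] pl e₁ ns pn e₂ = ⊥-elim (0≡r⇒1≰r e₁ 1≤r)
    on (l ∷ ls) pl e₁ ns pn e₂ = term₂≡weight r s a₁ a′ bs γ la lb lγ l ls ns pl pn e₁ e₂

  sumComps-term₃ : sumComps r s (term₃ r s as bs γ)
                 ≡ sumComp r (λ ls → sumComp s (λ ns → toℕ (length ns ≡ᵇ suc (length ls)) * WB ls ns))
  sumComps-term₃ = trans (sumComps≡sumComp r s _) (sumComp-cong-positive r (λ ls pl e₁ → sumComp-cong-positive s (on ls pl e₁)))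
    where
    on : ∀ ls → Positive ls → sum ls ≡ r → ∀ ns → Positive ns → sum ns ≡ s → _
    on [] pl e₁ ns pn e₂ = ⊥-elim (0≡r⇒1≰r e₁ 1≤r)
    on (l ∷ ls) pl e₁ ns pn e₂ = term₃≡weight r s as b₁ b′ γ la lb lγ l ls ns pl pn e₁ e₂

  sumComps-term₄ : sumComps r s (term₄ r s as bs γ)
                 ≡ sumComp r (λ ls → sumComp s (λ ns → toℕ (length ls ≡ᵇ length ns) * WB ls ns))
  sumComps-term₄ = trans (sumComps≡sumComp r s _) (sumComp-cong-positive r (λ ls pl e₁ → sumComp-cong-positive s (on ls pl e₁)))
    where
    on : ∀ ls → Positive ls → sum ls ≡ r → ∀ ns → Positive ns → sum ns ≡ s → _
    on [] pl e₁ ns pn e₂ = ⊥-elim (0≡r⇒1≰r e₁ 1≤r)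
    on (l ∷ ls) pl e₁ ns pn e₂ =
      trans (term₄≡weight r s as b₁ b′ γ la lb lγ l ls ns pl pn e₁ e₂)
            (cong (λ z → toℕ z * WB (l ∷ ls) ns) (≡ᵇ-comm (length ns) (length (l ∷ ls))))

  expansion≡cCoeff : expansionA (map toℤ as) (map toℤ bs) γ + expansionB (map toℤ as) (map toℤ bs) γ ≡ cCoeff r s as bs γ
  expansion≡cCoeff = begin
    expansionA (map toℤ as) (map toℤ bs) γ + expansionB (map toℤ as) (map toℤ bs) γ
      ≡⟨ cong₂ _+_ (cong₂ (λ m n → sumComp m (λ ls → sumComp n (λ ns → admissibleA ls ns * WA ls ns))) lU lV)
                   (cong₂ (λ m n → sumComp m (λ ls → sumComp n (λ ns → admissibleB ls ns * WB ls ns))) lU lV) ⟩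
    sumComp r (λ ls → sumComp s (λ ns → admissibleA ls ns * WA ls ns))
      + sumComp r (λ ls → sumComp s (λ ns → admissibleB ls ns * WB ls ns))
      ≡⟨ cong₂ _+_ (sumComp²-split r s (λ ls ns → toℕ (length ls ≡ᵇ suc (length ns))) (λ ls ns → toℕ (length ns ≡ᵇ length ls)) WA)
                   (sumComp²-split r s (λ ls ns → toℕ (length ns ≡ᵇ suc (length ls))) (λ ls ns → toℕ (length ls ≡ᵇ length ns)) WB) ⟩
    (sumComp r (λ ls → sumComp s (λ ns → toℕ (length ls ≡ᵇ suc (length ns)) * WA ls ns))
       + sumComp r (λ ls → sumComp s (λ ns → toℕ (length ns ≡ᵇ length ls) * WA ls ns)))
      + (sumComp r (λ ls → sumComp s (λ ns → toℕ (length ns ≡ᵇ suc (length ls)) * WB ls ns))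
       + sumComp r (λ ls → sumComp s (λ ns → toℕ (length ls ≡ᵇ length ns) * WB ls ns)))
      ≡⟨ sym (cong₂ _+_ (cong₂ _+_ sumComps-term₁ sumComps-term₂) (cong₂ _+_ sumComps-term₃ sumComps-term₄)) ⟩
    (sumComps r s (term₁ r s as bs γ) + sumComps r s (term₂ r s as bs γ))
      + (sumComps r s (term₃ r s as bs γ) + sumComps r s (term₄ r s as bs γ))
      ≡⟨ sym (NP.+-assoc (sumComps r s (term₁ r s as bs γ) + sumComps r s (term₂ r s as bs γ)) _ _) ⟩
    cCoeff r s as bs γ ∎
    where
    open ≡-Reasoning
    lU : length (map toℤ as) ≡ r
    lU = trans (LP.length-map toℤ as) la
    lV : length (map toℤ bs) ≡ s
    lV = trans (LP.length-map toℤ bs) lb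

shuffleCount≡cCoeff : ∀ r s → 1 ≤ r → 1 ≤ s → ∀ as bs γ → length as ≡ r → length bs ≡ s → length γ ≡ r + s →
  sum γ ≡ sum as + sum bs → shuffleCount (xy-word as) (xy-word bs) (xy-word γ) ≡ cCoeff r s as bs γ
shuffleCount≡cCoeff r s 1≤r 1≤s [] bs γ la lb lγ Σγ = ⊥-elim (0≡r⇒1≰r la 1≤r)
shuffleCount≡cCoeff r s 1≤r 1≤s (a₁ ∷ a′) [] γ la lb lγ Σγ = ⊥-elim (0≡r⇒1≰r lb 1≤s)
shuffleCount≡cCoeff r s 1≤r 1≤s (a₁ ∷ a′) (b₁ ∷ b′) γ la lb lγ Σγ = begin
  shuffleCount (xy-word (a₁ ∷ a′)) (xy-word (b₁ ∷ b′)) (xy-word γ)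
    ≡⟨ shuffleCount≡shuffleCountℤ γ (a₁ ∷ a′) (b₁ ∷ b′) ⟩
  shuffleCountℤ (map toℤ (a₁ ∷ a′)) (map toℤ (b₁ ∷ b′)) γ
    ≡⟨ shuffleCountℤ≡expansion γ (ℤ.+ a₁) (map toℤ a′) (ℤ.+ b₁) (map toℤ b′) lengths sums ⟩
  expansionA (map toℤ (a₁ ∷ a′)) (map toℤ (b₁ ∷ b′)) γ + expansionB (map toℤ (a₁ ∷ a′)) (map toℤ (b₁ ∷ b′)) γ
    ≡⟨ expansion≡cCoeff r s 1≤r 1≤s a₁ b₁ a′ b′ γ la lb lγ ⟩
  cCoeff r s (a₁ ∷ a′) (b₁ ∷ b′) γ ∎
  where
  open ≡-Reasoning
  lengths : length γ ≡ suc (length (map toℤ a′)) + suc (length (map toℤ b′))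
  lengths = trans lγ (cong₂ _+_ (sym (trans (LP.length-map toℤ (a₁ ∷ a′)) la)) (sym (trans (LP.length-map toℤ (b₁ ∷ b′)) lb)))
  sums : sumℤ (map toℤ γ) ≡ sumℤ (map toℤ (a₁ ∷ a′)) ℤ.+ sumℤ (map toℤ (b₁ ∷ b′))
  sums = trans (sumℤ-map-+ γ) (trans (cong toℤ Σγ) (sym (cong₂ ℤ._+_ (sumℤ-map-+ (a₁ ∷ a′)) (sumℤ-map-+ (b₁ ∷ b′)))))

theorem2p1 : (r s : ℕ) → 1 ≤ r → 1 ≤ s → (a : Vec ℕ r) (b : Vec ℕ s) →
    (xy-word (toList a) ш xy-word (toList b)) ≈𝔥 rhs r s (toList a) (toList b)
theorem2p1 r s 1≤r 1≤s a b =
  ≈𝔥-rhs (toList a) (toList b) r s (VP.length-toList a) (VP.length-toList b)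
    (λ γ lγ Σγ → shuffleCount≡cCoeff r s 1≤r 1≤s (toList a) (toList b) γ (VP.length-toList a) (VP.length-toList b) lγ Σγ)
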